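{- Let $p$ be prime, let $n$ be a positive integer with $\gcd(p,n)=1$, let $c\in\mathbb{Z}/p$, and let $T\in(\mathbb{Z}/p)[x]$ have at least two nonzero coefficients (so $A_p(c;T)$ is non-trivial). For $m\in\{1,n\}$, let $\mathscr{A}_m(k)$ denote the set of $k$-accessible blocks of $A_p(c;T^m)$. Then $\mathscr{A}_1(k)=\mathscr{A}_n(k)$ for all $k$. In particular, the line complexities of $A_p(c;T)$ and $A_p(c;T^n)$ coincide: $a_T(k)=a_{T^n}(k)$ for all $k$.
   Context: For a prime $p$, $c\in\mathbb{Z}/p$ and $S\in(\mathbb{Z}/p)[x]$, the automaton $A_p(c;S)$ has line $r\geq0$ equal to $c\,S(x)^r\in(\mathbb{Z}/p)[x]$. Each line is identified with the bi-infinite sequence $(a_j)_{j\in\mathbb{Z}}$ of its coefficients, with zeros outside the support. A string $w\in(\mathbb{Z}/p)^k$ is $k$-accessible if $w=(a_j,\dots,a_{j+k-1})$ for some line and some $j\in\mathbb{Z}$. $a_S(k)$ denotes the number of $k$-accessible blocks of $A_p(c;S)$ for $k\geq1$, with $a_S(0)=1$. The automaton is non-trivial if the transition rule has at least two nonzero coefficients. -}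

module Defs where

open import Data.Nat using (ℕ; zero; suc; _+_; _*_; _<_; NonZero)
open import Data.Nat.DivMod using (_mod_)
open import Data.Fin using (Fin; toℕ)
open import Data.Integer using (ℤ; +_; -[1+_])
import Data.Integer as ℤ
open import Data.List using (List; []; _∷_; map; length)
open import Data.List.Membership.Propositional using (_∈_)
open import Data.List.Relation.Unary.Unique.Propositional using (Unique)
open import Data.Vec using (Vec; tabulate)
open import Data.Product using (Σ; ∃; ∃-syntax; _×_)
open import Function.Bundles using (_⇔_)
open import Relation.Binary.PropositionalEquality using (_≡_; _≢_)

-- Polynomials over ℤ/p (elements of ℤ/p are Fin p), as coefficient lists,
-- constant coefficient first: (a₀ ∷ a₁ ∷ …) represents a₀ + a₁ x + …
Poly : ℕ → Set
Poly p = List (Fin p)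

module _ (p : ℕ) .{{_ : NonZero p}} where

  0ₚ 1ₚ : Fin p
  0ₚ = 0 mod p
  1ₚ = 1 mod p

  _+ₚ_ _*ₚ_ : Fin p → Fin p → Fin p
  a +ₚ b = (toℕ a + toℕ b) mod p
  a *ₚ b = (toℕ a * toℕ b) mod p

  polyAdd : Poly p → Poly p → Poly p
  polyAdd []       g        = g
  polyAdd f        []       = f
  polyAdd (a ∷ as) (b ∷ bs) = (a +ₚ b) ∷ polyAdd as bs

  polyScale : Fin p → Poly p → Poly p
  polyScale a g = map (a *ₚ_) g

  polyMul : Poly p → Poly p → Poly p
  polyMul []       g = []
  polyMul (a ∷ as) g = polyAdd (polyScale a g) (0ₚ ∷ polyMul as g)

  polyPow : Poly p → ℕ → Poly p
  polyPow S zero    = 1ₚ ∷ []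
  polyPow S (suc r) = polyMul S (polyPow S r)

  coeffℕ : Poly p → ℕ → Fin p
  coeffℕ []       _       = 0ₚ
  coeffℕ (a ∷ as) zero    = a
  coeffℕ (a ∷ as) (suc i) = coeffℕ as i

  coeffℤ : Poly p → ℤ → Fin p
  coeffℤ f (+ i)      = coeffℕ f i
  coeffℤ f -[1+ i ]   = 0ₚ

  -- line r of the automaton A_p(c;S): c · S(x)^r
  line : Fin p → Poly p → ℕ → Poly p
  line c S r = polyScale c (polyPow S r)

  block : Poly p → ℤ → (k : ℕ) → Vec (Fin p) k
  block f j k = tabulate (λ i → coeffℤ f (j ℤ.+ + toℕ i))

  Accessible : Fin p → Poly p → (k : ℕ) → Vec (Fin p) k → Set
  Accessible c S k w = ∃[ r ] ∃[ j ] block (line c S r) j k ≡ w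

  -- N is the number of k-accessible blocks of A_p(c;S), i.e. N = a_S(k)
  -- (for k = 0 the only block is the empty one, so this gives a_S(0) = 1)
  IsLineComplexity : Fin p → Poly p → (k : ℕ) → ℕ → Set
  IsLineComplexity c S k N =
    Σ (List (Vec (Fin p) k)) λ ws →
      Unique ws × (∀ w → (w ∈ ws) ⇔ Accessible c S k w) × length ws ≡ N

  NonTrivial : Poly p → Set
  NonTrivial S = ∃[ i ] ∃[ j ] (i < j × coeffℕ S i ≢ 0ₚ × coeffℕ S j ≢ 0ₚ)

-- Lines of A_p(c;T^n) are lines of A_p(c;T), so only the converse needs an argument. For q a power of p,
-- Frobenius gives T^(r+sq) = T^r · T^s(x^q); if T^s has a coefficient equal to 1 and T^r is shorter than q,
-- the line c T^(r+sq) contains the whole line c T^r surrounded by zeros. Since p is coprime to n we may take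
-- q ≡ 1 (mod n), and then r + sq is a multiple of n as soon as s ≡ -r (mod n). A suitable s exists because T
-- has two nonzero coefficients: the second coefficient of (u + v x^d + …)^m is m u^(m-1) v, so every nonzero
-- residue is a coefficient of some power of T^n (coefficients of powers being closed under products, again by
-- Frobenius), in particular the inverse of the lowest coefficient of T^((n-1)r).

module Submission where

open import Algebra.Bundles using (CommutativeSemiring)
open import Algebra.Structures.Biased using (isCommutativeSemiringˡ)
open import Data.Nat.Base using (ℕ; suc; NonZero)
open import Data.Nat.Primality using (Prime)
open import Data.Nat.Coprimality using (Coprime)
open import Defs using (Poly; NonTrivial)

module Arithmetic where

  open import Data.Empty using (⊥-elim)
  open import Data.Fin using (toℕ)
  open import Data.Fin.Properties using (toℕ-fromℕ<; pigeonhole)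
  open import Data.Nat
  open import Data.Nat.Properties
  open import Data.Nat.Combinatorics using (_C_; k![n∸k]!∣n!)
  open import Data.Nat.Combinatorics.Specification using (nCk≡n!/k![n-k]!)
  open import Data.Nat.Coprimality using (coprime-divisor)
  import Data.Nat.Coprimality as Coprimality
  open import Data.Nat.Divisibility
  open import Data.Nat.DivMod using (_mod_; m≡m%n+[m/n]*n; m/n*n≡m)
  open import Data.Nat.Primality using (Prime; euclidsLemma; prime⇒nonZero; ¬prime[1])
  open import Data.Nat.Tactic.RingSolver using (solve-∀)
  open import Data.Product using (_×_; _,_; ∃; ∃₂)
  open import Data.Sum using (inj₁; inj₂)
  open import Relation.Binary.PropositionalEquality
  open import Relation.Nullary using (¬_)

  %-≡⇒∣∸ : ∀ {m o} n .{{_ : NonZero n}} → m % n ≡ o % n → n ∣ o ∸ m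
  %-≡⇒∣∸ {m} {o} n eq = divides (o / n ∸ m / n) (begin
    o ∸ m                                     ≡⟨ cong₂ _∸_ (m≡m%n+[m/n]*n o n) (m≡m%n+[m/n]*n m n) ⟩
    (o % n + o / n * n) ∸ (m % n + m / n * n) ≡⟨ cong (λ r → (o % n + o / n * n) ∸ (r + m / n * n)) eq ⟩
    (o % n + o / n * n) ∸ (o % n + m / n * n) ≡⟨ [m+n]∸[m+o]≡n∸o (o % n) _ _ ⟩
    o / n * n ∸ m / n * n                     ≡⟨ *-distribʳ-∸ n (o / n) (m / n) ⟨
    (o / n ∸ m / n) * n                       ∎)
    where open ≡-Reasoning

  ∣∧<⇒≡0 : ∀ {m n} → n ∣ m → m < n → m ≡ 0
  ∣∧<⇒≡0 {zero}  _   _   = refl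
  ∣∧<⇒≡0 {suc m} n∣m m<n = ⊥-elim (<⇒≱ m<n (∣⇒≤ n∣m))

  n<m^n : ∀ {m} → 1 < m → ∀ n → n < m ^ n
  n<m^n         1<m zero    = s≤s z≤n
  n<m^n {m@(suc _)} 1<m (suc n) = ≤-<-trans (n<m^n 1<m n)
    (subst (m ^ n <_) (*-comm (m ^ n) m) (m<m*n (m ^ n) m {{m^n≢0 m n}} 1<m))

  prime∤! : ∀ {p} → Prime p → ∀ {m} → m < p → ¬ p ∣ m !
  prime∤! pr {zero}  _   p∣1 = ¬prime[1] (subst Prime (∣1⇒≡1 p∣1) pr)
  prime∤! pr {suc m} m<p p∣m! with euclidsLemma (suc m) (m !) pr p∣m!
  ... | inj₁ p∣m = <⇒≱ m<p (∣⇒≤ p∣m)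
  ... | inj₂ p∣m! = prime∤! pr (<-trans (n<1+n m) m<p) p∣m!

  nCk*k![n∸k]!≡n! : ∀ {n k} → k ≤ n → (n C k) * (k ! * (n ∸ k) !) ≡ n !
  nCk*k![n∸k]!≡n! {n} {k} k≤n = trans (cong (_* (k ! * (n ∸ k) !)) (nCk≡n!/k![n-k]! k≤n))
                                      (m/n*n≡m {{k !* (n ∸ k) !≢0}} (k![n∸k]!∣n! k≤n))

  n∣n! : ∀ n .{{_ : NonZero n}} → n ∣ n !
  n∣n! (suc n) = m∣m*n (n !)

  prime∣pCk : ∀ {p} → Prime p → ∀ {k} → 0 < k → k < p → p ∣ p C k
  prime∣pCk {p} pr {k} 0<k k<p
    with euclidsLemma (p C k) (k ! * (p ∸ k) !) pr
           (subst (p ∣_) (sym (nCk*k![n∸k]!≡n! (<⇒≤ k<p))) (n∣n! p {{prime⇒nonZero pr}}))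
  ... | inj₁ p∣pCk = p∣pCk
  ... | inj₂ p∣k![p∸k]! with euclidsLemma (k !) ((p ∸ k) !) pr p∣k![p∸k]!
  ...   | inj₁ p∣k!     = ⊥-elim (prime∤! pr k<p p∣k!)
  ...   | inj₂ p∣[p∸k]! = ⊥-elim (prime∤! pr (∸-monoʳ-< 0<k (<⇒≤ k<p)) p∣[p∸k]!)

  coprime-divisor-^ : ∀ {m n o} → Coprime n m → ∀ i → n ∣ m ^ i * o → n ∣ o
  coprime-divisor-^ {o = o} c zero    n∣o = subst (_ ∣_) (*-identityˡ o) n∣o
  coprime-divisor-^ {m} {n} c (suc i) n∣m*m^i*o =
    coprime-divisor-^ c i (coprime-divisor c (subst (n ∣_) (*-assoc m (m ^ i) _) n∣m*m^i*o))

  coprime⇒m^e≡1+n*h : ∀ {m} n .{{_ : NonZero m}} .{{_ : NonZero n}} → Coprime m n →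
                      ∃₂ λ e h → 0 < e × m ^ e ≡ 1 + n * h
  coprime⇒m^e≡1+n*h {m} n c with pigeonhole (n<1+n n) (λ i → (m ^ toℕ i) mod n)
  ... | i , j , i<j , m^i≡m^j = e , quotient n∣m^e∸1 , m<n⇒0<n∸m i<j , m^e≡1+n*h
    where
      e = toℕ j ∸ toℕ i
      m^j≡m^i*m^e : m ^ toℕ j ≡ m ^ toℕ i * m ^ e
      m^j≡m^i*m^e = trans (cong (m ^_) (sym (m+[n∸m]≡n (<⇒≤ i<j)))) (^-distribˡ-+-* m (toℕ i) e)
      n∣m^i*[m^e∸1] : n ∣ m ^ toℕ i * (m ^ e ∸ 1)
      n∣m^i*[m^e∸1] = subst (n ∣_)
        (trans (cong₂ _∸_ m^j≡m^i*m^e (sym (*-identityʳ (m ^ toℕ i)))) (sym (*-distribˡ-∸ (m ^ toℕ i) (m ^ e) 1)))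
        (%-≡⇒∣∸ n (trans (sym (toℕ-fromℕ< _)) (trans (cong toℕ m^i≡m^j) (toℕ-fromℕ< _))))
      n∣m^e∸1 : n ∣ m ^ e ∸ 1
      n∣m^e∸1 = coprime-divisor-^ (Coprimality.sym c) (toℕ i) n∣m^i*[m^e∸1]
      m^e≡1+n*h : m ^ e ≡ 1 + n * quotient n∣m^e∸1
      m^e≡1+n*h = trans (sym (m+[n∸m]≡n (m^n>0 m e)))
                        (cong (1 +_) (trans (_∣_.equality n∣m^e∸1) (*-comm _ n)))

  [1+n*h]^k≡1+n*h′ : ∀ n h k → ∃ λ h′ → (1 + n * h) ^ k ≡ 1 + n * h′
  [1+n*h]^k≡1+n*h′ n h zero = 0 , cong suc (sym (*-zeroʳ n))
  [1+n*h]^k≡1+n*h′ n h (suc k) with [1+n*h]^k≡1+n*h′ n h k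
  ... | h′ , eq = h + h′ + n * h * h′ , trans (cong ((1 + n * h) *_) eq) (expand n h h′)
    where
      expand : ∀ n h h′ → (1 + n * h) * (1 + n * h′) ≡ 1 + n * (h + h′ + n * h * h′)
      expand = solve-∀

  coprime⇒large-m^e≡1+n*h : ∀ {m} n .{{_ : NonZero m}} .{{_ : NonZero n}} → 1 < m → Coprime m n →
                            ∀ B → ∃₂ λ e h → B < m ^ e × m ^ e ≡ 1 + n * h
  coprime⇒large-m^e≡1+n*h {m} n 1<m c B with coprime⇒m^e≡1+n*h n c
  ... | e , h , 0<e , m^e≡1+n*h with [1+n*h]^k≡1+n*h′ n h B
  ...   | h′ , [1+n*h]^B≡1+n*h′ =
    e * B , h′ , <-≤-trans (n<m^n 1<m B) (^-monoʳ-≤ m (m≤n*m B e {{>-nonZero 0<e}})) ,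
    trans (sym (^-*-assoc m e B)) (trans (cong (_^ B) m^e≡1+n*h) [1+n*h]^B≡1+n*h′)

module ZMod (p : ℕ) .{{_ : NonZero p}} where

  open import Data.Fin using (Fin; toℕ)
  open import Data.Fin.Properties using (toℕ-injective; toℕ<n; toℕ-fromℕ<)
  open import Data.Nat
  open import Data.Nat.Properties
  open import Data.Nat.DivMod using (_mod_; %-distribˡ-+; %-distribˡ-*; m<n⇒m%n≡m)
  open import Data.Product using (_,_)
  open import Relation.Binary.PropositionalEquality
  import Defs as D

  infixl 6 _+ₚ_
  infixl 7 _*ₚ_

  0ₚ 1ₚ : Fin p
  0ₚ = D.0ₚ p
  1ₚ = D.1ₚ p

  _+ₚ_ _*ₚ_ : Fin p → Fin p → Fin p
  _+ₚ_ = D._+ₚ_ p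
  _*ₚ_ = D._*ₚ_ p

  ⟦_⟧ : ℕ → Fin p
  ⟦ m ⟧ = m mod p

  toℕ-⟦⟧ : ∀ m → toℕ ⟦ m ⟧ ≡ m % p
  toℕ-⟦⟧ m = toℕ-fromℕ< _

  ⟦toℕ⟧ : ∀ a → ⟦ toℕ a ⟧ ≡ a
  ⟦toℕ⟧ a = toℕ-injective (trans (toℕ-⟦⟧ (toℕ a)) (m<n⇒m%n≡m (toℕ<n a)))

  ⟦⟧-cong : ∀ {m n} → m % p ≡ n % p → ⟦ m ⟧ ≡ ⟦ n ⟧
  ⟦⟧-cong eq = toℕ-injective (trans (toℕ-⟦⟧ _) (trans eq (sym (toℕ-⟦⟧ _))))

  ⟦⟧-homo-+ : ∀ m n → ⟦ m + n ⟧ ≡ ⟦ m ⟧ +ₚ ⟦ n ⟧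
  ⟦⟧-homo-+ m n = ⟦⟧-cong (trans (%-distribˡ-+ m n p)
    (sym (cong₂ (λ x y → (x + y) % p) (toℕ-⟦⟧ m) (toℕ-⟦⟧ n))))

  ⟦⟧-homo-* : ∀ m n → ⟦ m * n ⟧ ≡ ⟦ m ⟧ *ₚ ⟦ n ⟧
  ⟦⟧-homo-* m n = ⟦⟧-cong (trans (%-distribˡ-* m n p)
    (sym (cong₂ (λ x y → (x * y) % p) (toℕ-⟦⟧ m) (toℕ-⟦⟧ n))))

  -- The semiring laws are transported from ℕ along the surjective homomorphism ⟦_⟧.
  +ₚ-assoc : ∀ a b c → (a +ₚ b) +ₚ c ≡ a +ₚ (b +ₚ c)
  +ₚ-assoc a b c = begin
    (a +ₚ b) +ₚ c                       ≡⟨ cong ((a +ₚ b) +ₚ_) (⟦toℕ⟧ c) ⟨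
    ⟦ toℕ a + toℕ b ⟧ +ₚ ⟦ toℕ c ⟧       ≡⟨ ⟦⟧-homo-+ _ _ ⟨
    ⟦ toℕ a + toℕ b + toℕ c ⟧           ≡⟨ cong ⟦_⟧ (+-assoc (toℕ a) _ _) ⟩
    ⟦ toℕ a + (toℕ b + toℕ c) ⟧         ≡⟨ ⟦⟧-homo-+ _ _ ⟩
    ⟦ toℕ a ⟧ +ₚ (b +ₚ c)               ≡⟨ cong (_+ₚ (b +ₚ c)) (⟦toℕ⟧ a) ⟩
    a +ₚ (b +ₚ c)                       ∎
    where open ≡-Reasoning

  *ₚ-assoc : ∀ a b c → (a *ₚ b) *ₚ c ≡ a *ₚ (b *ₚ c)
  *ₚ-assoc a b c = begin
    (a *ₚ b) *ₚ c                       ≡⟨ cong ((a *ₚ b) *ₚ_) (⟦toℕ⟧ c) ⟨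
    ⟦ toℕ a * toℕ b ⟧ *ₚ ⟦ toℕ c ⟧       ≡⟨ ⟦⟧-homo-* _ _ ⟨
    ⟦ toℕ a * toℕ b * toℕ c ⟧           ≡⟨ cong ⟦_⟧ (*-assoc (toℕ a) _ _) ⟩
    ⟦ toℕ a * (toℕ b * toℕ c) ⟧         ≡⟨ ⟦⟧-homo-* _ _ ⟩
    ⟦ toℕ a ⟧ *ₚ (b *ₚ c)               ≡⟨ cong (_*ₚ (b *ₚ c)) (⟦toℕ⟧ a) ⟩
    a *ₚ (b *ₚ c)                       ∎
    where open ≡-Reasoning

  +ₚ-comm : ∀ a b → a +ₚ b ≡ b +ₚ a
  +ₚ-comm a b = cong ⟦_⟧ (+-comm (toℕ a) (toℕ b))

  *ₚ-comm : ∀ a b → a *ₚ b ≡ b *ₚ a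
  *ₚ-comm a b = cong ⟦_⟧ (*-comm (toℕ a) (toℕ b))

  +ₚ-identityˡ : ∀ a → 0ₚ +ₚ a ≡ a
  +ₚ-identityˡ a = begin
    0ₚ +ₚ a              ≡⟨ cong (0ₚ +ₚ_) (⟦toℕ⟧ a) ⟨
    ⟦ 0 ⟧ +ₚ ⟦ toℕ a ⟧    ≡⟨ ⟦⟧-homo-+ 0 _ ⟨
    ⟦ toℕ a ⟧            ≡⟨ ⟦toℕ⟧ a ⟩
    a                    ∎
    where open ≡-Reasoning

  *ₚ-identityˡ : ∀ a → 1ₚ *ₚ a ≡ a
  *ₚ-identityˡ a = begin
    1ₚ *ₚ a              ≡⟨ cong (1ₚ *ₚ_) (⟦toℕ⟧ a) ⟨
    ⟦ 1 ⟧ *ₚ ⟦ toℕ a ⟧    ≡⟨ ⟦⟧-homo-* 1 _ ⟨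
    ⟦ 1 * toℕ a ⟧        ≡⟨ cong ⟦_⟧ (*-identityˡ (toℕ a)) ⟩
    ⟦ toℕ a ⟧            ≡⟨ ⟦toℕ⟧ a ⟩
    a                    ∎
    where open ≡-Reasoning

  *ₚ-zeroˡ : ∀ a → 0ₚ *ₚ a ≡ 0ₚ
  *ₚ-zeroˡ a = begin
    0ₚ *ₚ a              ≡⟨ cong (0ₚ *ₚ_) (⟦toℕ⟧ a) ⟨
    ⟦ 0 ⟧ *ₚ ⟦ toℕ a ⟧    ≡⟨ ⟦⟧-homo-* 0 _ ⟨
    0ₚ                   ∎
    where open ≡-Reasoning

  *ₚ-distribʳ-+ₚ : ∀ a b c → (b +ₚ c) *ₚ a ≡ b *ₚ a +ₚ c *ₚ a
  *ₚ-distribʳ-+ₚ a b c = begin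
    (b +ₚ c) *ₚ a                                   ≡⟨ cong ((b +ₚ c) *ₚ_) (⟦toℕ⟧ a) ⟨
    ⟦ toℕ b + toℕ c ⟧ *ₚ ⟦ toℕ a ⟧                   ≡⟨ ⟦⟧-homo-* _ _ ⟨
    ⟦ (toℕ b + toℕ c) * toℕ a ⟧                     ≡⟨ cong ⟦_⟧ (*-distribʳ-+ (toℕ a) (toℕ b) _) ⟩
    ⟦ toℕ b * toℕ a + toℕ c * toℕ a ⟧               ≡⟨ ⟦⟧-homo-+ _ _ ⟩
    b *ₚ a +ₚ c *ₚ a                                ∎
    where open ≡-Reasoning

  ℤ/p : CommutativeSemiring _ _
  ℤ/p = record
    { Carrier = Fin p ; _≈_ = _≡_ ; _+_ = _+ₚ_ ; _*_ = _*ₚ_ ; 0# = 0ₚ ; 1# = 1ₚ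
    ; isCommutativeSemiring = isCommutativeSemiringˡ record
      { +-isCommutativeMonoid = record
        { isMonoid = record
          { isSemigroup = record
            { isMagma = record { isEquivalence = isEquivalence ; ∙-cong = cong₂ _+ₚ_ }
            ; assoc = +ₚ-assoc }
          ; identity = +ₚ-identityˡ , λ a → trans (+ₚ-comm a 0ₚ) (+ₚ-identityˡ a) }
        ; comm = +ₚ-comm }
      ; *-isCommutativeMonoid = record
        { isMonoid = record
          { isSemigroup = record
            { isMagma = record { isEquivalence = isEquivalence ; ∙-cong = cong₂ _*ₚ_ }
            ; assoc = *ₚ-assoc }
          ; identity = *ₚ-identityˡ , λ a → trans (*ₚ-comm a 1ₚ) (*ₚ-identityˡ a) }
        ; comm = *ₚ-comm }
      ; distribʳ = *ₚ-distribʳ-+ₚ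
      ; zeroˡ = *ₚ-zeroˡ } }

  open CommutativeSemiring ℤ/p public using ()
    renaming (+-identityʳ to +ₚ-identityʳ; *-identityʳ to *ₚ-identityʳ; zeroʳ to *ₚ-zeroʳ; distribˡ to *ₚ-distribˡ-+ₚ)
  open import Algebra.Properties.Semiring.Mult (CommutativeSemiring.semiring ℤ/p) public
    using (×-assoc-*; ×-comm-*) renaming (_×_ to _·_)
  open import Algebra.Properties.Semiring.Exp (CommutativeSemiring.semiring ℤ/p) public
    using () renaming (_^_ to _^ₚ_; ^-assocʳ to ^ₚ-assocʳ)

module Frobenius {c ℓ} (R : CommutativeSemiring c ℓ) where

  open import Data.Fin using (Fin; toℕ; fromℕ; inject₁) renaming (zero to 0F; suc to 1+F)
  open import Data.Fin.Properties using (toℕ-fromℕ; inject₁ℕ<)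
  open import Data.Nat as ℕ using (ℕ; zero; suc; NonZero; _<_; z≤n; s≤s)
  import Data.Nat.Properties as ℕₚ
  open import Data.Nat.Combinatorics using (_C_; nCn≡1)
  open import Data.Nat.Divisibility using (divides)
  open import Data.Nat.Primality using (Prime; prime⇒nonZero)
  import Relation.Binary.PropositionalEquality as ≡
  open CommutativeSemiring R
  open import Algebra.Properties.Semiring.Mult semiring
  open import Algebra.Properties.Semiring.Exp semiring
  open import Algebra.Properties.Semiring.Sum semiring using (sum)
  import Algebra.Properties.CommutativeSemiring.Binomial R as Binomial
  open import Relation.Binary.Reasoning.Setoid setoid
  open Arithmetic using (prime∣pCk)

  sum≈last : ∀ m (t : Fin (suc m) → Carrier) → (∀ i → t (inject₁ i) ≈ 0#) → sum t ≈ t (fromℕ m)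
  sum≈last zero    t _    = +-identityʳ _
  sum≈last (suc m) t init≈0 =
    trans (+-cong (init≈0 0F) (sum≈last m (λ i → t (1+F i)) (λ i → init≈0 (1+F i)))) (+-identityˡ _)

  freshmansDream : ∀ n .{{_ : NonZero n}} → (∀ {k} → 0 < k → k < n → ∀ z → (n C k) × z ≈ 0#) →
                   ∀ x y → (x + y) ^ n ≈ x ^ n + y ^ n
  freshmansDream n@(suc m) C×≈0 x y = begin
    (x + y) ^ n
      ≈⟨ Binomial.theorem n x y ⟩
    Binomial.binomialExpansion x y n
      ≈⟨ +-cong first (sum≈last m (λ i → Binomial.binomialTerm x y n (1+F i)) middle) ⟩
    y ^ n + (n C toℕ (fromℕ n)) × Binomial.binomial x y n (fromℕ n)
      ≈⟨ +-congˡ last ⟩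
    y ^ n + x ^ n
      ≈⟨ +-comm (y ^ n) (x ^ n) ⟩
    x ^ n + y ^ n
      ∎
    where
      first : (n C 0) × (1# * y ^ n) ≈ y ^ n
      first = trans (+-congʳ (*-identityˡ _)) (+-identityʳ _)
      last : (n C toℕ (fromℕ n)) × Binomial.binomial x y n (fromℕ n) ≈ x ^ n
      last = trans (×-cong (≡.trans (≡.cong (n C_) (toℕ-fromℕ n)) (nCn≡1 n))
                           (*-congˡ (^-congʳ y (≡.trans (≡.cong (n ℕ.∸_) (toℕ-fromℕ n)) (ℕₚ.n∸n≡0 n)))))
                   (trans (+-identityʳ _) (trans (*-identityʳ _) (^-congʳ x (toℕ-fromℕ n))))
      middle : ∀ (i : Fin m) → Binomial.binomialTerm x y n (1+F (inject₁ i)) ≈ 0#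
      middle i = C×≈0 (s≤s z≤n) (s≤s (inject₁ℕ< i)) _

  module _ {p} (pr : Prime p) (charP : p × 1# ≈ 0#) where

    pCk×x≈0 : ∀ {k} → 0 < k → k < p → ∀ x → (p C k) × x ≈ 0#
    pCk×x≈0 {k} 0<k k<p x with prime∣pCk pr 0<k k<p
    ... | divides t eq = begin
      (p C k) × x                 ≈⟨ ×-congˡ eq ⟩
      (t ℕ.* p) × x               ≈⟨ ×-congʳ (t ℕ.* p) (*-identityˡ x) ⟨
      (t ℕ.* p) × (1# * x)        ≈⟨ ×-assoc-* (t ℕ.* p) 1# x ⟨
      (t ℕ.* p) × 1# * x          ≈⟨ *-congʳ (×1-homo-* t p) ⟩
      t × 1# * p × 1# * x         ≈⟨ *-congʳ (*-congˡ charP) ⟩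
      t × 1# * 0# * x             ≈⟨ *-congʳ (zeroʳ _) ⟩
      0# * x                      ≈⟨ zeroˡ x ⟩
      0#                          ∎

    frobenius : ∀ x y → (x + y) ^ p ≈ x ^ p + y ^ p
    frobenius = freshmansDream p {{prime⇒nonZero pr}} pCk×x≈0

    frobenius-^ : ∀ e x y → (x + y) ^ (p ℕ.^ e) ≈ x ^ (p ℕ.^ e) + y ^ (p ℕ.^ e)
    frobenius-^ zero    x y = trans (*-identityʳ _) (+-cong (sym (*-identityʳ x)) (sym (*-identityʳ y)))
    frobenius-^ (suc e) x y = begin
      (x + y) ^ (p ℕ.* q)                   ≈⟨ ^-congʳ _ (ℕₚ.*-comm p q) ⟩
      (x + y) ^ (q ℕ.* p)                   ≈⟨ ^-assocʳ _ q p ⟨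
      ((x + y) ^ q) ^ p                     ≈⟨ ^-congˡ p (frobenius-^ e x y) ⟩
      (x ^ q + y ^ q) ^ p                   ≈⟨ frobenius _ _ ⟩
      (x ^ q) ^ p + (y ^ q) ^ p             ≈⟨ +-cong (^-assocʳ x q p) (^-assocʳ y q p) ⟩
      x ^ (q ℕ.* p) + y ^ (q ℕ.* p)         ≈⟨ +-cong (^-congʳ x (ℕₚ.*-comm q p)) (^-congʳ y (ℕₚ.*-comm q p)) ⟩
      x ^ (p ℕ.* q) + y ^ (p ℕ.* q)         ∎
      where q = p ℕ.^ e

module ZModPrime (p : ℕ) .{{_ : NonZero p}} (pr : Prime p) where

  open import Data.Fin using (Fin; toℕ)
  open import Data.Fin.Properties using (toℕ-injective; toℕ<n)
  open import Data.Nat as ℕ using (zero; suc; _*_; _∸_; _<_; _≤_; s≤s; z≤n; ≢-nonZero; nonTrivial⇒n>1)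
  open import Data.Nat.Properties
  open import Data.Nat.Coprimality using (Coprime; coprime-divisor; prime⇒coprime)
  open import Data.Nat.Divisibility using (_∣_; ∣-refl; m%n≡0⇒n∣m)
  open import Data.Nat.DivMod using (m<n⇒m%n≡m; n%n≡0)
  open import Data.Nat.Primality using (prime⇒nonTrivial)
  open import Data.Product using (_,_)
  open import Relation.Binary.PropositionalEquality
  open ZMod p public
  open Frobenius ℤ/p using (frobenius)
  open Arithmetic using (%-≡⇒∣∸; ∣∧<⇒≡0)

  1<p : 1 < p
  1<p = nonTrivial⇒n>1 p {{prime⇒nonTrivial pr}}

  toℕ-0ₚ : toℕ 0ₚ ≡ 0
  toℕ-0ₚ = trans (toℕ-⟦⟧ 0) (m<n⇒m%n≡m (<-trans (s≤s z≤n) 1<p))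

  1ₚ≢0ₚ : 1ₚ ≢ 0ₚ
  1ₚ≢0ₚ 1≡0 = 1+n≢0 (trans (sym (trans (toℕ-⟦⟧ 1) (m<n⇒m%n≡m 1<p))) (trans (cong toℕ 1≡0) toℕ-0ₚ))

  n·1ₚ≡⟦n⟧ : ∀ n → n · 1ₚ ≡ ⟦ n ⟧
  n·1ₚ≡⟦n⟧ zero    = refl
  n·1ₚ≡⟦n⟧ (suc n) = trans (cong (1ₚ +ₚ_) (n·1ₚ≡⟦n⟧ n)) (sym (⟦⟧-homo-+ 1 n))

  toℕ·1ₚ : ∀ a → toℕ a · 1ₚ ≡ a
  toℕ·1ₚ a = trans (n·1ₚ≡⟦n⟧ (toℕ a)) (⟦toℕ⟧ a)

  p·1ₚ≡0ₚ : p · 1ₚ ≡ 0ₚ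
  p·1ₚ≡0ₚ = trans (n·1ₚ≡⟦n⟧ p) (⟦⟧-cong (trans (n%n≡0 p) (sym (m<n⇒m%n≡m (<-trans (s≤s z≤n) 1<p)))))

  fermat : ∀ a → a ^ₚ p ≡ a
  fermat a = trans (cong (_^ₚ p) (sym (toℕ·1ₚ a))) (trans (n·1ₚ^p (toℕ a)) (toℕ·1ₚ a))
    where
      1ₚ^k : ∀ k → 1ₚ ^ₚ k ≡ 1ₚ
      1ₚ^k zero    = refl
      1ₚ^k (suc k) = trans (cong (1ₚ *ₚ_) (1ₚ^k k)) (*ₚ-identityˡ 1ₚ)
      n·1ₚ^p : ∀ n → (n · 1ₚ) ^ₚ p ≡ n · 1ₚ
      n·1ₚ^p zero    = trans (cong (0ₚ ^ₚ_) (sym (suc-pred p))) (*ₚ-zeroˡ _)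
      n·1ₚ^p (suc n) = trans (frobenius pr p·1ₚ≡0ₚ 1ₚ (n · 1ₚ)) (cong₂ _+ₚ_ (1ₚ^k p) (n·1ₚ^p n))

  fermat-^ : ∀ e a → a ^ₚ (p ℕ.^ e) ≡ a
  fermat-^ zero    a = *ₚ-identityʳ a
  fermat-^ (suc e) a = begin
    a ^ₚ (p * p ℕ.^ e)         ≡⟨ cong (a ^ₚ_) (*-comm p (p ℕ.^ e)) ⟩
    a ^ₚ (p ℕ.^ e * p)         ≡⟨ ^ₚ-assocʳ a (p ℕ.^ e) p ⟨
    (a ^ₚ (p ℕ.^ e)) ^ₚ p      ≡⟨ cong (_^ₚ p) (fermat-^ e a) ⟩
    a ^ₚ p                     ≡⟨ fermat a ⟩
    a                          ∎
    where open ≡-Reasoning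

  *ₚ-cancelˡ : ∀ {a b c} → a ≢ 0ₚ → a *ₚ b ≡ a *ₚ c → b ≡ c
  *ₚ-cancelˡ {a} a≢0 ab≡ac = toℕ-injective (≤-antisym (≥-from (sym ab≡ac)) (≥-from ab≡ac))
    where
      toℕa≢0 : toℕ a ≢ 0
      toℕa≢0 ta≡0 = a≢0 (toℕ-injective (trans ta≡0 (sym toℕ-0ₚ)))
      coprime : Coprime p (toℕ a)
      coprime = prime⇒coprime pr {{≢-nonZero toℕa≢0}} (toℕ<n a)
      ≥-from : ∀ {x y} → a *ₚ x ≡ a *ₚ y → toℕ y ≤ toℕ x
      ≥-from {x} {y} ax≡ay = m∸n≡0⇒m≤n (∣∧<⇒≡0 p∣y∸x (≤-<-trans (m∸n≤m (toℕ y) (toℕ x)) (toℕ<n y)))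
        where
          p∣y∸x : p ∣ toℕ y ∸ toℕ x
          p∣y∸x = coprime-divisor coprime (subst (p ∣_) (sym (*-distribˡ-∸ (toℕ a) (toℕ y) (toℕ x)))
                    (%-≡⇒∣∸ p (trans (sym (toℕ-⟦⟧ _)) (trans (cong toℕ ax≡ay) (toℕ-⟦⟧ _)))))

  *ₚ-≢0 : ∀ {a b} → a ≢ 0ₚ → b ≢ 0ₚ → a *ₚ b ≢ 0ₚ
  *ₚ-≢0 {a} a≢0 b≢0 ab≡0 = b≢0 (*ₚ-cancelˡ a≢0 (trans ab≡0 (sym (*ₚ-zeroʳ a))))

  ^ₚ-≢0 : ∀ {a} → a ≢ 0ₚ → ∀ k → a ^ₚ k ≢ 0ₚ
  ^ₚ-≢0 a≢0 zero    = 1ₚ≢0ₚ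
  ^ₚ-≢0 a≢0 (suc k) = *ₚ-≢0 a≢0 (^ₚ-≢0 a≢0 k)

  _⁻¹ : Fin p → Fin p
  a ⁻¹ = a ^ₚ (p ∸ 2)

  ⁻¹-≢0 : ∀ {a} → a ≢ 0ₚ → a ⁻¹ ≢ 0ₚ
  ⁻¹-≢0 a≢0 = ^ₚ-≢0 a≢0 (p ∸ 2)

  *ₚ-inverseʳ : ∀ {a} → a ≢ 0ₚ → a *ₚ a ⁻¹ ≡ 1ₚ
  *ₚ-inverseʳ {a} a≢0 = *ₚ-cancelˡ a≢0 (begin
    a *ₚ (a *ₚ a ⁻¹)   ≡⟨ cong (a ^ₚ_) (m+[n∸m]≡n 1<p) ⟩
    a ^ₚ p              ≡⟨ fermat a ⟩
    a                   ≡⟨ *ₚ-identityʳ a ⟨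
    a *ₚ 1ₚ             ∎)
    where open ≡-Reasoning

  coprime⇒·1ₚ≢0ₚ : ∀ {n} → Coprime p n → n · 1ₚ ≢ 0ₚ
  coprime⇒·1ₚ≢0ₚ {n} c n·1≡0 = <⇒≢ 1<p (sym (c (∣-refl , p∣n)))
    where
      p∣n : p ∣ n
      p∣n = m%n≡0⇒n∣m n p (trans (sym (toℕ-⟦⟧ n))
              (trans (cong toℕ (sym (n·1ₚ≡⟦n⟧ n))) (trans (cong toℕ n·1≡0) toℕ-0ₚ)))

module Polynomial (p : ℕ) .{{_ : NonZero p}} where

  open import Algebra.Bundles using (CommutativeMonoid)
  open import Data.Fin using (Fin)
  open import Data.List using ([]; _∷_; _++_; replicate; length)
  open import Data.Nat as ℕ using (zero; suc; _+_; _<_; _≤_; s≤s)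
  open import Data.Product using (_,_)
  open import Relation.Binary.Bundles using (Setoid)
  open import Relation.Binary.PropositionalEquality hiding ([_])
  open import Defs using (Poly; polyAdd; polyMul; polyScale; coeffℕ; polyPow)
  open ZMod p

  infixl 6 _+ᴾ_
  infixl 7 _*ᴾ_
  infix 4 _≋_

  _+ᴾ_ _*ᴾ_ : Poly p → Poly p → Poly p
  _+ᴾ_ = polyAdd p
  _*ᴾ_ = polyMul p

  scale : Fin p → Poly p → Poly p
  scale = polyScale p

  coeff : Poly p → ℕ → Fin p
  coeff = coeffℕ p

  1ᴾ : Poly p
  1ᴾ = 1ₚ ∷ []

  +ᴾ-identityʳ : ∀ f → f +ᴾ [] ≡ f
  +ᴾ-identityʳ []      = refl
  +ᴾ-identityʳ (_ ∷ _) = refl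

  +ᴾ-comm : ∀ f g → f +ᴾ g ≡ g +ᴾ f
  +ᴾ-comm []      g       = sym (+ᴾ-identityʳ g)
  +ᴾ-comm (_ ∷ _) []      = refl
  +ᴾ-comm (a ∷ f) (b ∷ g) = cong₂ _∷_ (+ₚ-comm a b) (+ᴾ-comm f g)

  +ᴾ-assoc : ∀ f g h → (f +ᴾ g) +ᴾ h ≡ f +ᴾ (g +ᴾ h)
  +ᴾ-assoc []      _       _       = refl
  +ᴾ-assoc (_ ∷ _) []      _       = refl
  +ᴾ-assoc (_ ∷ _) (_ ∷ _) []      = refl
  +ᴾ-assoc (a ∷ f) (b ∷ g) (c ∷ h) = cong₂ _∷_ (+ₚ-assoc a b c) (+ᴾ-assoc f g h)

  +ᴾ-commutativeMonoid : CommutativeMonoid _ _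
  +ᴾ-commutativeMonoid = record
    { Carrier = Poly p ; _≈_ = _≡_ ; _∙_ = _+ᴾ_ ; ε = []
    ; isCommutativeMonoid = record
      { isMonoid = record
        { isSemigroup = record
          { isMagma = record { isEquivalence = isEquivalence ; ∙-cong = cong₂ _+ᴾ_ }
          ; assoc = +ᴾ-assoc }
        ; identity = (λ _ → refl) , +ᴾ-identityʳ }
      ; comm = +ᴾ-comm } }

  open import Algebra.Properties.CommutativeSemigroup
    (CommutativeMonoid.commutativeSemigroup +ᴾ-commutativeMonoid)
    using () renaming (interchange to +ᴾ-interchange; x∙yz≈y∙xz to +ᴾ-left-comm)

  scale-+ᴾ : ∀ a f g → scale a (f +ᴾ g) ≡ scale a f +ᴾ scale a g
  scale-+ᴾ a []      _       = refl
  scale-+ᴾ a (_ ∷ _) []      = refl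
  scale-+ᴾ a (b ∷ f) (c ∷ g) = cong₂ _∷_ (*ₚ-distribˡ-+ₚ a b c) (scale-+ᴾ a f g)

  scale-scale : ∀ a b f → scale a (scale b f) ≡ scale (a *ₚ b) f
  scale-scale a b []      = refl
  scale-scale a b (c ∷ f) = cong₂ _∷_ (sym (*ₚ-assoc a b c)) (scale-scale a b f)

  scale-1ₚ : ∀ f → scale 1ₚ f ≡ f
  scale-1ₚ []      = refl
  scale-1ₚ (a ∷ f) = cong₂ _∷_ (*ₚ-identityˡ a) (scale-1ₚ f)

  coeff-+ᴾ : ∀ f g i → coeff (f +ᴾ g) i ≡ coeff f i +ₚ coeff g i
  coeff-+ᴾ []      g       i       = sym (+ₚ-identityˡ _)
  coeff-+ᴾ (_ ∷ _) []      i       = sym (+ₚ-identityʳ _)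
  coeff-+ᴾ (_ ∷ _) (_ ∷ _) zero    = refl
  coeff-+ᴾ (_ ∷ f) (_ ∷ g) (suc i) = coeff-+ᴾ f g i

  coeff-scale : ∀ a f i → coeff (scale a f) i ≡ a *ₚ coeff f i
  coeff-scale a []      i       = sym (*ₚ-zeroʳ a)
  coeff-scale a (_ ∷ _) zero    = refl
  coeff-scale a (_ ∷ f) (suc i) = coeff-scale a f i

  -- Lists with trailing zeros represent the same polynomial, so polynomial equality is coefficientwise.
  record _≋_ (f g : Poly p) : Set where
    constructor mk≋
    field at : ∀ i → coeff f i ≡ coeff g i
  open _≋_ public

  ≋-setoid : Setoid _ _
  ≋-setoid = record
    { Carrier = Poly p ; _≈_ = _≋_
    ; isEquivalence = record
      { refl  = mk≋ λ _ → refl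
      ; sym   = λ f≋g → mk≋ λ i → sym (at f≋g i)
      ; trans = λ f≋g g≋h → mk≋ λ i → trans (at f≋g i) (at g≋h i) } }

  open Setoid ≋-setoid public using () renaming (refl to ≋-refl; sym to ≋-sym; trans to ≋-trans)

  ≡⇒≋ : ∀ {f g} → f ≡ g → f ≋ g
  ≡⇒≋ refl = ≋-refl

  ∷-cong : ∀ {a b f g} → a ≡ b → f ≋ g → a ∷ f ≋ b ∷ g
  ∷-cong a≡b f≋g = mk≋ λ { zero → a≡b ; (suc i) → at f≋g i }

  0ₚ∷-≋[] : ∀ {f} → f ≋ [] → 0ₚ ∷ f ≋ []
  0ₚ∷-≋[] f≋[] = mk≋ λ { zero → refl ; (suc i) → at f≋[] i }

  +ᴾ-cong : ∀ {f f′ g g′} → f ≋ f′ → g ≋ g′ → f +ᴾ g ≋ f′ +ᴾ g′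
  +ᴾ-cong {f} {f′} {g} {g′} f≋f′ g≋g′ = mk≋ λ i →
    trans (coeff-+ᴾ f g i) (trans (cong₂ _+ₚ_ (at f≋f′ i) (at g≋g′ i)) (sym (coeff-+ᴾ f′ g′ i)))

  scale-cong : ∀ {a b f g} → a ≡ b → f ≋ g → scale a f ≋ scale b g
  scale-cong {a} {b} {f} {g} a≡b f≋g = mk≋ λ i →
    trans (coeff-scale a f i) (trans (cong₂ _*ₚ_ a≡b (at f≋g i)) (sym (coeff-scale b g i)))

  scale-0ₚ : ∀ f → scale 0ₚ f ≋ []
  scale-0ₚ f = mk≋ λ i → trans (coeff-scale 0ₚ f i) (*ₚ-zeroˡ (coeff f i))

  *ᴾ-zeroˡ-≋ : ∀ {f} g → f ≋ [] → f *ᴾ g ≋ []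
  *ᴾ-zeroˡ-≋ {[]}    g _    = ≋-refl
  *ᴾ-zeroˡ-≋ {a ∷ f} g f≋[] = ≋-trans
    (+ᴾ-cong (scale-cong (at f≋[] 0) (≋-refl {g})) (∷-cong refl (*ᴾ-zeroˡ-≋ {f} g (mk≋ λ i → at f≋[] (suc i)))))
    (+ᴾ-cong (scale-0ₚ g) (0ₚ∷-≋[] (≋-refl {[]})))

  *ᴾ-congˡ : ∀ {f f′} g → f ≋ f′ → f *ᴾ g ≋ f′ *ᴾ g
  *ᴾ-congˡ {[]}    {f′}     g f≋f′ = ≋-sym (*ᴾ-zeroˡ-≋ g (≋-sym f≋f′))
  *ᴾ-congˡ {_ ∷ _} {[]}     g f≋f′ = *ᴾ-zeroˡ-≋ g f≋f′
  *ᴾ-congˡ {_ ∷ f} {_ ∷ f′} g f≋f′ =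
    +ᴾ-cong (scale-cong (at f≋f′ 0) (≋-refl {g})) (∷-cong refl (*ᴾ-congˡ {f} {f′} g (mk≋ λ i → at f≋f′ (suc i))))

  *ᴾ-congʳ : ∀ f {g g′} → g ≋ g′ → f *ᴾ g ≋ f *ᴾ g′
  *ᴾ-congʳ []      g≋g′ = ≋-refl
  *ᴾ-congʳ (a ∷ f) g≋g′ = +ᴾ-cong (scale-cong {a} refl g≋g′) (∷-cong refl (*ᴾ-congʳ f g≋g′))

  *ᴾ-cong : ∀ {f f′ g g′} → f ≋ f′ → g ≋ g′ → f *ᴾ g ≋ f′ *ᴾ g′
  *ᴾ-cong {f′ = f′} {g} f≋f′ g≋g′ = ≋-trans (*ᴾ-congˡ g f≋f′) (*ᴾ-congʳ f′ g≋g′)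

  *ᴾ-zeroʳ : ∀ f → f *ᴾ [] ≋ []
  *ᴾ-zeroʳ []      = ≋-refl
  *ᴾ-zeroʳ (_ ∷ f) = 0ₚ∷-≋[] (*ᴾ-zeroʳ f)

  0ₚ∷-*ᴾ : ∀ f g → (0ₚ ∷ f) *ᴾ g ≋ 0ₚ ∷ f *ᴾ g
  0ₚ∷-*ᴾ f g = +ᴾ-cong (scale-0ₚ g) ≋-refl

  *ᴾ-distribʳ-+ᴾ : ∀ h f g → (f +ᴾ g) *ᴾ h ≋ f *ᴾ h +ᴾ g *ᴾ h
  *ᴾ-distribʳ-+ᴾ h []      g       = ≋-refl
  *ᴾ-distribʳ-+ᴾ h (a ∷ f) []      = ≡⇒≋ (sym (+ᴾ-identityʳ _))
  *ᴾ-distribʳ-+ᴾ h (a ∷ f) (b ∷ g) = begin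
    scale (a +ₚ b) h +ᴾ (0ₚ ∷ (f +ᴾ g) *ᴾ h)
      ≈⟨ +ᴾ-cong scale-distrib (∷-cong (sym (+ₚ-identityˡ 0ₚ)) (*ᴾ-distribʳ-+ᴾ h f g)) ⟩
    (scale a h +ᴾ scale b h) +ᴾ ((0ₚ ∷ f *ᴾ h) +ᴾ (0ₚ ∷ g *ᴾ h))
      ≈⟨ ≡⇒≋ (+ᴾ-interchange (scale a h) (scale b h) _ _) ⟩
    (scale a h +ᴾ (0ₚ ∷ f *ᴾ h)) +ᴾ (scale b h +ᴾ (0ₚ ∷ g *ᴾ h)) ∎
    where
      open import Relation.Binary.Reasoning.Setoid ≋-setoid
      scale-distrib : scale (a +ₚ b) h ≋ scale a h +ᴾ scale b h
      scale-distrib = mk≋ λ i → trans (coeff-scale (a +ₚ b) h i) (trans (*ₚ-distribʳ-+ₚ (coeff h i) a b)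
        (trans (cong₂ _+ₚ_ (sym (coeff-scale a h i)) (sym (coeff-scale b h i))) (sym (coeff-+ᴾ (scale a h) (scale b h) i))))

  *ᴾ-distribˡ-+ᴾ : ∀ f g h → f *ᴾ (g +ᴾ h) ≋ f *ᴾ g +ᴾ f *ᴾ h
  *ᴾ-distribˡ-+ᴾ []      g h = ≋-refl
  *ᴾ-distribˡ-+ᴾ (a ∷ f) g h = ≋-trans
    (+ᴾ-cong (≡⇒≋ (scale-+ᴾ a g h)) (∷-cong (sym (+ₚ-identityˡ 0ₚ)) (*ᴾ-distribˡ-+ᴾ f g h)))
    (≡⇒≋ (+ᴾ-interchange (scale a g) (scale a h) _ _))

  scale-*ᴾ : ∀ a f g → scale a f *ᴾ g ≋ scale a (f *ᴾ g)
  scale-*ᴾ a []      g = ≋-refl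
  scale-*ᴾ a (b ∷ f) g = begin
    scale (a *ₚ b) g +ᴾ (0ₚ ∷ scale a f *ᴾ g)
      ≈⟨ +ᴾ-cong (≡⇒≋ (sym (scale-scale a b g))) (∷-cong (sym (*ₚ-zeroʳ a)) (scale-*ᴾ a f g)) ⟩
    scale a (scale b g) +ᴾ scale a (0ₚ ∷ f *ᴾ g)
      ≈⟨ ≡⇒≋ (scale-+ᴾ a (scale b g) _) ⟨
    scale a (scale b g +ᴾ (0ₚ ∷ f *ᴾ g))
      ∎
    where open import Relation.Binary.Reasoning.Setoid ≋-setoid

  *ᴾ-identityˡ : ∀ g → 1ᴾ *ᴾ g ≋ g
  *ᴾ-identityˡ g = ≋-trans (+ᴾ-cong (≡⇒≋ (scale-1ₚ g)) (0ₚ∷-≋[] ≋-refl)) (≡⇒≋ (+ᴾ-identityʳ g))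

  *ᴾ-identityʳ : ∀ f → f *ᴾ 1ᴾ ≋ f
  *ᴾ-identityʳ []      = ≋-refl
  *ᴾ-identityʳ (a ∷ f) = ∷-cong (trans (+ₚ-identityʳ _) (*ₚ-identityʳ a)) (*ᴾ-identityʳ f)

  *ᴾ-∷ʳ : ∀ f a g → f *ᴾ (a ∷ g) ≋ scale a f +ᴾ (0ₚ ∷ f *ᴾ g)
  *ᴾ-∷ʳ []      a g = ≋-sym (0ₚ∷-≋[] ≋-refl)
  *ᴾ-∷ʳ (b ∷ f) a g = ∷-cong (cong (_+ₚ 0ₚ) (*ₚ-comm b a)) (≋-trans
    (+ᴾ-cong (≋-refl {scale b g}) (*ᴾ-∷ʳ f a g)) (≡⇒≋ (+ᴾ-left-comm (scale b g) (scale a f) _)))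

  *ᴾ-comm : ∀ f g → f *ᴾ g ≋ g *ᴾ f
  *ᴾ-comm []      g = ≋-sym (*ᴾ-zeroʳ g)
  *ᴾ-comm (a ∷ f) g = ≋-trans (+ᴾ-cong (≋-refl {scale a g}) (∷-cong refl (*ᴾ-comm f g))) (≋-sym (*ᴾ-∷ʳ g a f))

  *ᴾ-assoc : ∀ f g h → (f *ᴾ g) *ᴾ h ≋ f *ᴾ (g *ᴾ h)
  *ᴾ-assoc []      g h = ≋-refl
  *ᴾ-assoc (a ∷ f) g h = ≋-trans (*ᴾ-distribʳ-+ᴾ h (scale a g) (0ₚ ∷ f *ᴾ g))
    (+ᴾ-cong (scale-*ᴾ a g h) (≋-trans (0ₚ∷-*ᴾ (f *ᴾ g) h) (∷-cong refl (*ᴾ-assoc f g h))))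

  ℤ/p[x] : CommutativeSemiring _ _
  ℤ/p[x] = record
    { Carrier = Poly p ; _≈_ = _≋_ ; _+_ = _+ᴾ_ ; _*_ = _*ᴾ_ ; 0# = [] ; 1# = 1ᴾ
    ; isCommutativeSemiring = isCommutativeSemiringˡ record
      { +-isCommutativeMonoid = record
        { isMonoid = record
          { isSemigroup = record
            { isMagma = record { isEquivalence = Setoid.isEquivalence ≋-setoid ; ∙-cong = +ᴾ-cong }
            ; assoc = λ f g h → ≡⇒≋ (+ᴾ-assoc f g h) }
          ; identity = (λ _ → ≋-refl) , λ f → ≡⇒≋ (+ᴾ-identityʳ f) }
        ; comm = λ f g → ≡⇒≋ (+ᴾ-comm f g) }
      ; *-isCommutativeMonoid = record
        { isMonoid = record
          { isSemigroup = record
            { isMagma = record { isEquivalence = Setoid.isEquivalence ≋-setoid ; ∙-cong = *ᴾ-cong }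
            ; assoc = *ᴾ-assoc }
          ; identity = *ᴾ-identityˡ , *ᴾ-identityʳ }
        ; comm = *ᴾ-comm }
      ; distribʳ = *ᴾ-distribʳ-+ᴾ
      ; zeroˡ = λ _ → ≋-refl } }

  open CommutativeSemiring ℤ/p[x] public using () renaming (semiring to ℤ/p[x]-semiring)
  open import Algebra.Properties.Semiring.Exp ℤ/p[x]-semiring public using ()
    renaming (_^_ to _^ᴾ_; ^-homo-* to ^ᴾ-homo-*; ^-assocʳ to ^ᴾ-assocʳ; ^-congˡ to ^ᴾ-congˡ)
  open import Algebra.Properties.CommutativeSemiring.Exp ℤ/p[x] public using ()
    renaming (^-distrib-* to ^ᴾ-distrib-*)

  polyPow≡^ᴾ : ∀ f r → polyPow p f r ≡ f ^ᴾ r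
  polyPow≡^ᴾ f zero    = refl
  polyPow≡^ᴾ f (suc r) = cong (f *ᴾ_) (polyPow≡^ᴾ f r)

  []^ᴾ : ∀ n .{{_ : ℕ.NonZero n}} → [] ^ᴾ n ≋ []
  []^ᴾ (suc n) = ≋-refl

  [_] : Fin p → Poly p
  [ a ] = a ∷ []

  [a]*ᴾ : ∀ a g → [ a ] *ᴾ g ≋ scale a g
  [a]*ᴾ a g = ≋-trans (+ᴾ-cong (≋-refl {scale a g}) (0ₚ∷-≋[] (≋-refl {[]}))) (≡⇒≋ (+ᴾ-identityʳ _))

  [a]^ᴾ : ∀ a k → [ a ] ^ᴾ k ≋ [ a ^ₚ k ]
  [a]^ᴾ a zero    = ≋-refl
  [a]^ᴾ a (suc k) = ≋-trans (*ᴾ-congʳ [ a ] ([a]^ᴾ a k)) ([a]*ᴾ a [ a ^ₚ k ])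

  shift : ℕ → Poly p → Poly p
  shift k f = replicate k 0ₚ ++ f

  X : Poly p
  X = shift 1 1ᴾ

  ∷≋[a]+ᴾshift1 : ∀ a f → a ∷ f ≋ [ a ] +ᴾ shift 1 f
  ∷≋[a]+ᴾshift1 a f = ∷-cong (sym (+ₚ-identityʳ a)) (≋-refl {f})

  shift-cong : ∀ k {f g} → f ≋ g → shift k f ≋ shift k g
  shift-cong zero    f≋g = f≋g
  shift-cong (suc k) f≋g = ∷-cong refl (shift-cong k f≋g)

  shift-*ᴾ : ∀ k f g → shift k f *ᴾ g ≋ shift k (f *ᴾ g)
  shift-*ᴾ zero    f g = ≋-refl
  shift-*ᴾ (suc k) f g = ≋-trans (0ₚ∷-*ᴾ (shift k f) g) (∷-cong refl (shift-*ᴾ k f g))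

  *ᴾ-shift : ∀ k f g → f *ᴾ shift k g ≋ shift k (f *ᴾ g)
  *ᴾ-shift k f g = ≋-trans (*ᴾ-comm f (shift k g)) (≋-trans (shift-*ᴾ k g f) (shift-cong k (*ᴾ-comm g f)))

  X*ᴾ : ∀ f → X *ᴾ f ≋ shift 1 f
  X*ᴾ f = ≋-trans (shift-*ᴾ 1 1ᴾ f) (shift-cong 1 (*ᴾ-identityˡ f))

  X^ᴾ*ᴾ : ∀ k f → X ^ᴾ k *ᴾ f ≋ shift k f
  X^ᴾ*ᴾ zero    f = *ᴾ-identityˡ f
  X^ᴾ*ᴾ (suc k) f = ≋-trans (*ᴾ-assoc X (X ^ᴾ k) f) (≋-trans (X*ᴾ _) (shift-cong 1 (X^ᴾ*ᴾ k f)))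

  shift-+ᴾ : ∀ k f g → shift k f +ᴾ shift k g ≋ shift k (f +ᴾ g)
  shift-+ᴾ zero    f g = ≋-refl
  shift-+ᴾ (suc k) f g = ∷-cong (+ₚ-identityˡ 0ₚ) (shift-+ᴾ k f g)

  scale-shift : ∀ a k f → scale a (shift k f) ≋ shift k (scale a f)
  scale-shift a zero    f = ≋-refl
  scale-shift a (suc k) f = ∷-cong (*ₚ-zeroʳ a) (scale-shift a k f)

  coeff-shift-< : ∀ k f {i} → i < k → coeff (shift k f) i ≡ 0ₚ
  coeff-shift-< (suc k) f {zero}  _         = refl
  coeff-shift-< (suc k) f {suc i} (s≤s i<k) = coeff-shift-< k f i<k

  coeff-shift-+ : ∀ k f i → coeff (shift k f) (k + i) ≡ coeff f i
  coeff-shift-+ zero    f i = refl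
  coeff-shift-+ (suc k) f i = coeff-shift-+ k f i

  coeff-≥length : ∀ f {i} → length f ≤ i → coeff f i ≡ 0ₚ
  coeff-≥length []      _         = refl
  coeff-≥length (_ ∷ f) (s≤s f≤i) = coeff-≥length f f≤i

module PolynomialFrobenius (p : ℕ) .{{_ : NonZero p}} (pr : Prime p) where

  open import Data.List using ([]; _∷_; length)
  open import Data.Nat as ℕ using (zero; suc; _+_; _*_; _<_; _≤_)
  import Data.Nat.Properties as ℕₚ
  open import Data.Nat.Tactic.RingSolver using (solve-∀)
  open import Relation.Binary.PropositionalEquality hiding ([_])
  open import Defs using (Poly)
  open ZModPrime p pr
  open Polynomial p public
  open import Algebra.Properties.Semiring.Mult ℤ/p[x]-semiring using () renaming (_×_ to _·ᴾ_)
  open Frobenius ℤ/p[x] using () renaming (frobenius-^ to frobeniusᴾ-^)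

  n·ᴾ1ᴾ : ∀ n → n ·ᴾ 1ᴾ ≋ [ n · 1ₚ ]
  n·ᴾ1ᴾ zero    = ≋-sym (0ₚ∷-≋[] (≋-refl {[]}))
  n·ᴾ1ᴾ (suc n) = +ᴾ-cong (≋-refl {1ᴾ}) (n·ᴾ1ᴾ n)

  p·ᴾ1ᴾ≋[] : p ·ᴾ 1ᴾ ≋ []
  p·ᴾ1ᴾ≋[] = ≋-trans (n·ᴾ1ᴾ p) (≋-trans (∷-cong p·1ₚ≡0ₚ (≋-refl {[]})) (0ₚ∷-≋[] (≋-refl {[]})))

  dilate : ℕ → Poly p → Poly p
  dilate q []      = []
  dilate q (a ∷ f) = [ a ] +ᴾ shift q (dilate q f)

  frobeniusᴾ : ∀ e f → f ^ᴾ (p ℕ.^ e) ≋ dilate (p ℕ.^ e) f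
  frobeniusᴾ e []      = []^ᴾ (p ℕ.^ e) {{ℕₚ.m^n≢0 p e}}
  frobeniusᴾ e (a ∷ f) = begin
    (a ∷ f) ^ᴾ q                   ≈⟨ ^ᴾ-congˡ q a∷f≋[a]+X*f ⟩
    ([ a ] +ᴾ X *ᴾ f) ^ᴾ q         ≈⟨ frobeniusᴾ-^ pr p·ᴾ1ᴾ≋[] e [ a ] (X *ᴾ f) ⟩
    [ a ] ^ᴾ q +ᴾ (X *ᴾ f) ^ᴾ q     ≈⟨ +ᴾ-cong ([a]^ᴾ a q) (^ᴾ-distrib-* X f q) ⟩
    [ a ^ₚ q ] +ᴾ X ^ᴾ q *ᴾ f ^ᴾ q  ≈⟨ +ᴾ-cong (∷-cong (fermat-^ e a) (≋-refl {[]})) (X^ᴾ*ᴾ q (f ^ᴾ q)) ⟩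
    [ a ] +ᴾ shift q (f ^ᴾ q)       ≈⟨ +ᴾ-cong (≋-refl {[ a ]}) (shift-cong q (frobeniusᴾ e f)) ⟩
    [ a ] +ᴾ shift q (dilate q f)   ∎
    where
      open import Relation.Binary.Reasoning.Setoid ≋-setoid
      q = p ℕ.^ e
      a∷f≋[a]+X*f : a ∷ f ≋ [ a ] +ᴾ X *ᴾ f
      a∷f≋[a]+X*f = ≋-trans (∷≋[a]+ᴾshift1 a f) (+ᴾ-cong (≋-refl {[ a ]}) (≋-sym (X*ᴾ f)))

  coeff-*ᴾ-dilate : ∀ {q} F G {t} i → length F ≤ q → t < q →
                    coeff (F *ᴾ dilate q G) (t + q * i) ≡ coeff F t *ₚ coeff G i
  coeff-*ᴾ-dilate {q} F []      {t} i |F|≤q t<q = trans (at (*ᴾ-zeroʳ F) _) (sym (*ₚ-zeroʳ (coeff F t)))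
  coeff-*ᴾ-dilate {q} F (g ∷ G) {t} i |F|≤q t<q = trans (at split (t + q * i)) (coeff-split i)
    where
      H = F *ᴾ dilate q G
      split : F *ᴾ dilate q (g ∷ G) ≋ scale g F +ᴾ shift q H
      split = ≋-trans (*ᴾ-distribˡ-+ᴾ F [ g ] (shift q (dilate q G)))
        (+ᴾ-cong (≋-trans (*ᴾ-comm F [ g ]) ([a]*ᴾ g F)) (*ᴾ-shift q F (dilate q G)))
      coeff-split : ∀ i → coeff (scale g F +ᴾ shift q H) (t + q * i) ≡ coeff F t *ₚ coeff (g ∷ G) i
      coeff-split zero = begin
        coeff (scale g F +ᴾ shift q H) (t + q * 0)             ≡⟨ cong (coeff (scale g F +ᴾ shift q H)) t+q*0≡t ⟩
        coeff (scale g F +ᴾ shift q H) t                       ≡⟨ coeff-+ᴾ (scale g F) (shift q H) t ⟩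
        coeff (scale g F) t +ₚ coeff (shift q H) t             ≡⟨ cong₂ _+ₚ_ (coeff-scale g F t) (coeff-shift-< q H t<q) ⟩
        g *ₚ coeff F t +ₚ 0ₚ                                   ≡⟨ +ₚ-identityʳ _ ⟩
        g *ₚ coeff F t                                         ≡⟨ *ₚ-comm g (coeff F t) ⟩
        coeff F t *ₚ g                                         ∎
        where
          open ≡-Reasoning
          t+q*0≡t : t + q * 0 ≡ t
          t+q*0≡t = trans (cong (t +_) (ℕₚ.*-zeroʳ q)) (ℕₚ.+-identityʳ t)
      coeff-split (suc i) = begin
        coeff (scale g F +ᴾ shift q H) (t + q * suc i)         ≡⟨ cong (coeff (scale g F +ᴾ shift q H)) (reindex t q i) ⟩
        coeff (scale g F +ᴾ shift q H) (q + m)                 ≡⟨ coeff-+ᴾ (scale g F) (shift q H) (q + m) ⟩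
        coeff (scale g F) (q + m) +ₚ coeff (shift q H) (q + m) ≡⟨ cong₂ _+ₚ_ beyond-F (coeff-shift-+ q H m) ⟩
        0ₚ +ₚ coeff H m                                        ≡⟨ +ₚ-identityˡ _ ⟩
        coeff H m                                              ≡⟨ coeff-*ᴾ-dilate F G i |F|≤q t<q ⟩
        coeff F t *ₚ coeff G i                                 ∎
        where
          open ≡-Reasoning
          m = t + q * i
          reindex : ∀ t q i → t + q * suc i ≡ q + (t + q * i)
          reindex = solve-∀
          beyond-F : coeff (scale g F) (q + m) ≡ 0ₚ
          beyond-F = trans (coeff-scale g F (q + m))
            (trans (cong (g *ₚ_) (coeff-≥length F (ℕₚ.≤-trans |F|≤q (ℕₚ.m≤m+n q m)))) (*ₚ-zeroʳ g))

  coeff-^ᴾ-split : ∀ T a b e {t} i → length (T ^ᴾ a) ≤ p ℕ.^ e → t < p ℕ.^ e →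
                   coeff (T ^ᴾ (a + b * p ℕ.^ e)) (t + p ℕ.^ e * i) ≡ coeff (T ^ᴾ a) t *ₚ coeff (T ^ᴾ b) i
  coeff-^ᴾ-split T a b e i |T^a|≤q t<q =
    trans (at T^[a+bq]≋T^a*T^b[x^q] _) (coeff-*ᴾ-dilate (T ^ᴾ a) (T ^ᴾ b) i |T^a|≤q t<q)
    where
      q = p ℕ.^ e
      T^[a+bq]≋T^a*T^b[x^q] : T ^ᴾ (a + b * q) ≋ T ^ᴾ a *ᴾ dilate q (T ^ᴾ b)
      T^[a+bq]≋T^a*T^b[x^q] = ≋-trans (^ᴾ-homo-* T a (b * q))
        (*ᴾ-congʳ (T ^ᴾ a) (≋-trans (≋-sym (^ᴾ-assocʳ T b q)) (frobeniusᴾ e (T ^ᴾ b))))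

module LowestTermsOfPowers (p : ℕ) .{{_ : NonZero p}} (pr : Prime p) where

  open import Data.Empty using (⊥-elim)
  open import Data.Fin as Fin using (Fin)
  open import Data.List using ([]; _∷_)
  open import Data.Nat as ℕ using (zero; suc; _+_; _*_; _∸_; _≤_; z≤n; s≤s)
  import Data.Nat.Properties as ℕₚ
  open import Data.Product using (_×_; _,_; ∃; ∃₂)
  open import Relation.Binary.PropositionalEquality hiding ([_])
  open import Relation.Nullary using (yes; no)
  open import Defs using (Poly; NonTrivial)
  open ZModPrime p pr
  open PolynomialFrobenius p pr

  twoTerms : Fin p → ℕ → Fin p → Poly p → Poly p
  twoTerms u d v R = [ u ] +ᴾ shift (suc d) (v ∷ R)

  record LowestTerms (T : Poly p) : Set where
    field
      o d : ℕ
      u v : Fin p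
      R   : Poly p
      u≢0 : u ≢ 0ₚ
      v≢0 : v ≢ 0ₚ
      T≋  : T ≋ shift o (twoTerms u d v R)

  coeff-lowest : ∀ o u d v R → coeff (shift o (twoTerms u d v R)) o ≡ u
  coeff-lowest o u d v R = trans (cong (coeff (shift o (twoTerms u d v R))) (sym (ℕₚ.+-identityʳ o)))
    (trans (coeff-shift-+ o (twoTerms u d v R) 0) (+ₚ-identityʳ u))

  coeff-second : ∀ o u d v R → coeff (shift o (twoTerms u d v R)) (o + suc d) ≡ v
  coeff-second o u d v R = trans (coeff-shift-+ o (twoTerms u d v R) (suc d))
    (trans (cong (coeff (shift d (v ∷ R))) (sym (ℕₚ.+-identityʳ d))) (coeff-shift-+ d (v ∷ R) 0))

  secondCoefficient-step : ∀ {u c v w} j → c *ₚ u ≡ j · (w *ₚ v) →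
                           (u *ₚ c +ₚ w *ₚ v +ₚ 0ₚ) *ₚ u ≡ suc j · ((u *ₚ w) *ₚ v)
  secondCoefficient-step {u} {c} {v} {w} j c*u≡j·wv = begin
    (u *ₚ c +ₚ w *ₚ v +ₚ 0ₚ) *ₚ u         ≡⟨ cong (_*ₚ u) (+ₚ-identityʳ _) ⟩
    (u *ₚ c +ₚ w *ₚ v) *ₚ u               ≡⟨ *ₚ-distribʳ-+ₚ u (u *ₚ c) (w *ₚ v) ⟩
    u *ₚ c *ₚ u +ₚ w *ₚ v *ₚ u            ≡⟨ cong₂ _+ₚ_ (*ₚ-assoc u c u)
                                               (trans (*ₚ-comm (w *ₚ v) u) (sym (*ₚ-assoc u w v))) ⟩
    u *ₚ (c *ₚ u) +ₚ u *ₚ w *ₚ v          ≡⟨ cong (λ x → u *ₚ x +ₚ u *ₚ w *ₚ v) c*u≡j·wv ⟩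
    u *ₚ (j · (w *ₚ v)) +ₚ u *ₚ w *ₚ v    ≡⟨ cong (_+ₚ u *ₚ w *ₚ v) (×-comm-* j u (w *ₚ v)) ⟩
    j · (u *ₚ (w *ₚ v)) +ₚ u *ₚ w *ₚ v    ≡⟨ cong (λ x → j · x +ₚ u *ₚ w *ₚ v) (sym (*ₚ-assoc u w v)) ⟩
    j · (u *ₚ w *ₚ v) +ₚ u *ₚ w *ₚ v      ≡⟨ +ₚ-comm (j · (u *ₚ w *ₚ v)) (u *ₚ w *ₚ v) ⟩
    suc j · (u *ₚ w *ₚ v)                 ∎
    where open ≡-Reasoning

  -- The second coefficient c of (u + v x^(d+1) + …)^j is j u^(j-1) v; it is pinned down by c u = j u^j v.
  twoTerms-^ᴾ : ∀ u d v R j → ∃₂ λ c R′ →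
                c *ₚ u ≡ j · (u ^ₚ j *ₚ v) × twoTerms u d v R ^ᴾ j ≋ twoTerms (u ^ₚ j) d c R′
  twoTerms-^ᴾ u d v R zero = 0ₚ , [] , *ₚ-zeroˡ u ,
    ∷-cong (sym (+ₚ-identityʳ 1ₚ)) (≋-sym (shift[0ₚ]≋[] d))
    where
      shift[0ₚ]≋[] : ∀ k → shift k [ 0ₚ ] ≋ []
      shift[0ₚ]≋[] zero    = 0ₚ∷-≋[] (≋-refl {[]})
      shift[0ₚ]≋[] (suc k) = 0ₚ∷-≋[] (shift[0ₚ]≋[] k)
  twoTerms-^ᴾ u d v R (suc j) with twoTerms-^ᴾ u d v R j
  ... | c , R′ , c*u≡j·wv , T^j≋ = _ , _ , secondCoefficient-step j c*u≡j·wv , (begin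
    (A +ᴾ B) *ᴾ twoTerms u d v R ^ᴾ j
      ≈⟨ *ᴾ-congʳ (A +ᴾ B) T^j≋ ⟩
    (A +ᴾ B) *ᴾ (C +ᴾ D)
      ≈⟨ *ᴾ-distribʳ-+ᴾ (C +ᴾ D) A B ⟩
    A *ᴾ (C +ᴾ D) +ᴾ B *ᴾ (C +ᴾ D)
      ≈⟨ +ᴾ-cong (*ᴾ-distribˡ-+ᴾ A C D) (*ᴾ-distribˡ-+ᴾ B C D) ⟩
    (A *ᴾ C +ᴾ A *ᴾ D) +ᴾ (B *ᴾ C +ᴾ B *ᴾ D)
      ≈⟨ ≡⇒≋ (+ᴾ-assoc (A *ᴾ C) (A *ᴾ D) (B *ᴾ C +ᴾ B *ᴾ D)) ⟩
    A *ᴾ C +ᴾ (A *ᴾ D +ᴾ (B *ᴾ C +ᴾ B *ᴾ D))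
      ≈⟨ +ᴾ-cong ([a]*ᴾ u C) (≡⇒≋ (sym (+ᴾ-assoc (A *ᴾ D) (B *ᴾ C) (B *ᴾ D)))) ⟩
    [ u *ₚ w ] +ᴾ ((A *ᴾ D +ᴾ B *ᴾ C) +ᴾ B *ᴾ D)
      ≈⟨ +ᴾ-cong (≋-refl {[ u *ₚ w ]}) (+ᴾ-cong (+ᴾ-cong AD BC) BD) ⟩
    [ u *ₚ w ] +ᴾ ((S (scale u (c ∷ R′)) +ᴾ S (scale w (v ∷ R))) +ᴾ S (S W))
      ≈⟨ +ᴾ-cong (≋-refl {[ u *ₚ w ]})
                 (≋-trans (+ᴾ-cong (shift-+ᴾ (suc d) _ _) (≋-refl {S (S W)})) (shift-+ᴾ (suc d) _ _)) ⟩
    [ u *ₚ w ] +ᴾ S ((scale u (c ∷ R′) +ᴾ scale w (v ∷ R)) +ᴾ S W)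
      ∎)
    where
      open import Relation.Binary.Reasoning.Setoid ≋-setoid
      w = u ^ₚ j
      S = shift (suc d)
      W = (v ∷ R) *ᴾ (c ∷ R′)
      A = [ u ]
      B = S (v ∷ R)
      C = [ w ]
      D = S (c ∷ R′)
      AD : A *ᴾ D ≋ S (scale u (c ∷ R′))
      AD = ≋-trans ([a]*ᴾ u D) (scale-shift u (suc d) (c ∷ R′))
      BC : B *ᴾ C ≋ S (scale w (v ∷ R))
      BC = ≋-trans (*ᴾ-comm B C) (≋-trans ([a]*ᴾ w B) (scale-shift w (suc d) (v ∷ R)))
      BD : B *ᴾ D ≋ S (S W)
      BD = ≋-trans (shift-*ᴾ (suc d) (v ∷ R) D) (shift-cong (suc d) (*ᴾ-shift (suc d) (v ∷ R) (c ∷ R′)))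

  lowestNonzero : ∀ F {i} → coeff F i ≢ 0ₚ → ∃₂ λ o u → ∃ λ G → o ≤ i × u ≢ 0ₚ × F ≋ shift o (u ∷ G)
  lowestNonzero []      F₀≢0 = ⊥-elim (F₀≢0 refl)
  lowestNonzero (a ∷ F) {i}     Fᵢ≢0 with a Fin.≟ 0ₚ
  lowestNonzero (a ∷ F) {i}     Fᵢ≢0 | no a≢0  = 0 , a , F , z≤n , a≢0 , ≋-refl
  lowestNonzero (a ∷ F) {zero}  Fᵢ≢0 | yes a≡0 = ⊥-elim (Fᵢ≢0 a≡0)
  lowestNonzero (a ∷ F) {suc i} Fᵢ≢0 | yes a≡0 with lowestNonzero F Fᵢ≢0
  ... | o , u , G , o≤i , u≢0 , F≋ = suc o , u , G , s≤s o≤i , u≢0 , ∷-cong a≡0 F≋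

  nonTrivial⇒lowestTerms : ∀ {T} → NonTrivial p T → LowestTerms T
  nonTrivial⇒lowestTerms {T} (i , j , i<j , Tᵢ≢0 , Tⱼ≢0) with lowestNonzero T Tᵢ≢0
  ... | o , u , G , o≤i , u≢0 , T≋x^o[u∷G] with lowestNonzero G G_m≢0
    where
      m = j ∸ suc o
      j≡o+1+m : o + suc m ≡ j
      j≡o+1+m = trans (ℕₚ.+-suc o m) (ℕₚ.m+[n∸m]≡n (ℕₚ.≤-<-trans o≤i i<j))
      G_m≢0 : coeff G m ≢ 0ₚ
      G_m≢0 G_m≡0 = Tⱼ≢0 (begin
        coeff T j                         ≡⟨ cong (coeff T) j≡o+1+m ⟨
        coeff T (o + suc m)               ≡⟨ at T≋x^o[u∷G] (o + suc m) ⟩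
        coeff (shift o (u ∷ G)) (o + suc m) ≡⟨ coeff-shift-+ o (u ∷ G) (suc m) ⟩
        coeff G m                         ≡⟨ G_m≡0 ⟩
        0ₚ                                ∎)
        where open ≡-Reasoning
  ... | d , v , R , _ , v≢0 , G≋x^d[v∷R] = record
    { o = o ; d = d ; u = u ; v = v ; R = R ; u≢0 = u≢0 ; v≢0 = v≢0
    ; T≋ = ≋-trans T≋x^o[u∷G] (shift-cong o (≋-trans (∷-cong refl G≋x^d[v∷R]) (∷≋[a]+ᴾshift1 u _))) }

  module _ {T} (lt : LowestTerms T) where
    open LowestTerms lt

    lowestTerms-^ᴾ : ∀ j → ∃₂ λ c R′ →
                     c *ₚ u ≡ j · (u ^ₚ j *ₚ v) × T ^ᴾ j ≋ shift (o * j) (twoTerms (u ^ₚ j) d c R′)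
    lowestTerms-^ᴾ j with twoTerms-^ᴾ u d v R j
    ... | c , R′ , c*u≡ , G^j≋ = c , R′ , c*u≡ , (begin
      T ^ᴾ j                                   ≈⟨ ^ᴾ-congˡ j (≋-trans T≋ (≋-sym (X^ᴾ*ᴾ o G))) ⟩
      (X ^ᴾ o *ᴾ G) ^ᴾ j                       ≈⟨ ^ᴾ-distrib-* (X ^ᴾ o) G j ⟩
      (X ^ᴾ o) ^ᴾ j *ᴾ G ^ᴾ j                  ≈⟨ *ᴾ-cong (^ᴾ-assocʳ X o j) G^j≋ ⟩
      X ^ᴾ (o * j) *ᴾ twoTerms (u ^ₚ j) d c R′ ≈⟨ X^ᴾ*ᴾ (o * j) _ ⟩
      shift (o * j) (twoTerms (u ^ₚ j) d c R′) ∎)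
      where
        open import Relation.Binary.Reasoning.Setoid ≋-setoid
        G = twoTerms u d v R

    coeff-^ᴾ-lowest : ∀ j → coeff (T ^ᴾ j) (o * j) ≡ u ^ₚ j
    coeff-^ᴾ-lowest j with lowestTerms-^ᴾ j
    ... | c , R′ , _ , T^j≋ = trans (at T^j≋ (o * j)) (coeff-lowest (o * j) (u ^ₚ j) d c R′)

    coprime⇒lowestTerms-^ᴾ : ∀ {n} → Coprime p n → LowestTerms (T ^ᴾ n)
    coprime⇒lowestTerms-^ᴾ {n} coprime with lowestTerms-^ᴾ n
    ... | c , R′ , c*u≡ , T^n≋ = record
      { o = o * n ; d = d ; u = u ^ₚ n ; v = c ; R = R′
      ; u≢0 = ^ₚ-≢0 u≢0 n ; v≢0 = c≢0 ; T≋ = T^n≋ }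
      where
        c≢0 : c ≢ 0ₚ
        c≢0 c≡0 = *ₚ-≢0 (coprime⇒·1ₚ≢0ₚ coprime) (*ₚ-≢0 (^ₚ-≢0 u≢0 n) v≢0) (begin
          (n · 1ₚ) *ₚ (u ^ₚ n *ₚ v)   ≡⟨ ×-assoc-* n 1ₚ _ ⟩
          n · (1ₚ *ₚ (u ^ₚ n *ₚ v))   ≡⟨ cong (n ·_) (*ₚ-identityˡ _) ⟩
          n · (u ^ₚ n *ₚ v)           ≡⟨ c*u≡ ⟨
          c *ₚ u                      ≡⟨ cong (_*ₚ u) c≡0 ⟩
          0ₚ *ₚ u                     ≡⟨ *ₚ-zeroˡ u ⟩
          0ₚ                          ∎)
          where open ≡-Reasoning

module CoefficientsOfPowers (p : ℕ) .{{_ : NonZero p}} (pr : Prime p) where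

  open import Data.Fin using (Fin; toℕ)
  open import Data.List using (length)
  open import Data.Nat as ℕ using (zero; suc; _+_; _*_; _∸_)
  import Data.Nat.Properties as ℕₚ
  open import Data.Product using (_,_; ∃₂)
  open import Relation.Binary.PropositionalEquality hiding ([_])
  open import Defs using (Poly)
  open ZModPrime p pr
  open PolynomialFrobenius p pr
  open LowestTermsOfPowers p pr
  open Arithmetic using (n<m^n)

  CoeffOfPower : Poly p → Fin p → Set
  CoeffOfPower U z = ∃₂ λ b i → coeff (U ^ᴾ b) i ≡ z

  module _ {U : Poly p} where

    coeffOfPower-coeff : ∀ {i z} → coeff U i ≡ z → CoeffOfPower U z
    coeffOfPower-coeff {i} Uᵢ≡z = 1 , i , trans (at (*ᴾ-identityʳ U) i) Uᵢ≡z

    coeffOfPower-*ₚ : ∀ {z₁ z₂} → CoeffOfPower U z₁ → CoeffOfPower U z₂ → CoeffOfPower U (z₁ *ₚ z₂)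
    coeffOfPower-*ₚ (b₁ , i₁ , eq₁) (b₂ , i₂ , eq₂) =
      b₁ + b₂ * p ℕ.^ e , i₁ + p ℕ.^ e * i₂ ,
      trans (coeff-^ᴾ-split U b₁ b₂ e i₂ |U^b₁|≤p^e i₁<p^e) (cong₂ _*ₚ_ eq₁ eq₂)
      where
        e = length (U ^ᴾ b₁) + i₁
        e<p^e = n<m^n 1<p e
        |U^b₁|≤p^e = ℕₚ.≤-trans (ℕₚ.m≤m+n _ i₁) (ℕₚ.<⇒≤ e<p^e)
        i₁<p^e = ℕₚ.≤-<-trans (ℕₚ.m≤n+m i₁ _) e<p^e

    coeffOfPower-^ₚ : ∀ {z} → CoeffOfPower U z → ∀ k → CoeffOfPower U (z ^ₚ k)
    coeffOfPower-^ₚ z∈ zero    = 0 , 0 , refl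
    coeffOfPower-^ₚ z∈ (suc k) = coeffOfPower-*ₚ z∈ (coeffOfPower-^ₚ z∈ k)

    -- With m = toℕ z, the second coefficient c of U^m satisfies c u = z u^m v, so z = c u (u^m)⁻¹ v⁻¹.
    lowestTerms⇒coeffOfPower : LowestTerms U → ∀ {z} → z ≢ 0ₚ → CoeffOfPower U z
    lowestTerms⇒coeffOfPower lt {z} z≢0 with lowestTerms-^ᴾ lt (toℕ z)
    ... | c , R′ , c*u≡ , U^m≋ = subst (CoeffOfPower U) c*u*[u^m]⁻¹*v⁻¹≡z
      (coeffOfPower-*ₚ (coeffOfPower-*ₚ (coeffOfPower-*ₚ c∈ u∈) (coeffOfPower-^ₚ u^m∈ (p ∸ 2)))
                       (coeffOfPower-^ₚ v∈ (p ∸ 2)))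
      where
        open LowestTerms lt
        m = toℕ z
        a = u ^ₚ m
        u∈ : CoeffOfPower U u
        u∈ = coeffOfPower-coeff (trans (at T≋ o) (coeff-lowest o u d v R))
        v∈ : CoeffOfPower U v
        v∈ = coeffOfPower-coeff (trans (at T≋ (o + suc d)) (coeff-second o u d v R))
        c∈ : CoeffOfPower U c
        c∈ = m , o * m + suc d , trans (at U^m≋ _) (coeff-second (o * m) a d c R′)
        u^m∈ : CoeffOfPower U a
        u^m∈ = m , o * m , coeff-^ᴾ-lowest lt m
        c*u≡z*[a*v] : c *ₚ u ≡ z *ₚ (a *ₚ v)
        c*u≡z*[a*v] = begin
          c *ₚ u                   ≡⟨ c*u≡ ⟩
          m · (a *ₚ v)             ≡⟨ cong (m ·_) (*ₚ-identityˡ _) ⟨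
          m · (1ₚ *ₚ (a *ₚ v))     ≡⟨ ×-assoc-* m 1ₚ _ ⟨
          (m · 1ₚ) *ₚ (a *ₚ v)     ≡⟨ cong (_*ₚ (a *ₚ v)) (toℕ·1ₚ z) ⟩
          z *ₚ (a *ₚ v)            ∎
          where open ≡-Reasoning
        c*u*[u^m]⁻¹*v⁻¹≡z : c *ₚ u *ₚ a ⁻¹ *ₚ v ⁻¹ ≡ z
        c*u*[u^m]⁻¹*v⁻¹≡z = begin
          c *ₚ u *ₚ a ⁻¹ *ₚ v ⁻¹                  ≡⟨ cong (λ x → x *ₚ a ⁻¹ *ₚ v ⁻¹) c*u≡z*[a*v] ⟩
          z *ₚ (a *ₚ v) *ₚ a ⁻¹ *ₚ v ⁻¹           ≡⟨ regroup z a v (a ⁻¹) (v ⁻¹) ⟩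
          z *ₚ ((a *ₚ a ⁻¹) *ₚ (v *ₚ v ⁻¹))       ≡⟨ cong₂ (λ x y → z *ₚ (x *ₚ y))
                                                         (*ₚ-inverseʳ (^ₚ-≢0 u≢0 m)) (*ₚ-inverseʳ v≢0) ⟩
          z *ₚ (1ₚ *ₚ 1ₚ)                         ≡⟨ cong (z *ₚ_) (*ₚ-identityˡ 1ₚ) ⟩
          z *ₚ 1ₚ                                 ≡⟨ *ₚ-comm z 1ₚ ⟩
          1ₚ *ₚ z                                 ≡⟨ *ₚ-identityˡ z ⟩
          z                                       ∎
          where
            open ≡-Reasoning
            open import Algebra.Solver.Ring.NaturalCoefficients.Default ℤ/p
            regroup : ∀ z a v a′ v′ → z *ₚ (a *ₚ v) *ₚ a′ *ₚ v′ ≡ z *ₚ ((a *ₚ a′) *ₚ (v *ₚ v′))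
            regroup = solve 5 (λ z a v a′ v′ → z :* (a :* v) :* a′ :* v′ := z :* ((a :* a′) :* (v :* v′))) refl

module Blocks (p : ℕ) .{{_ : NonZero p}} where

  open import Data.Fin using (Fin; toℕ)
  open import Data.Fin.Properties using (toℕ<n)
  open import Data.Integer as ℤ using (ℤ; +_; -[1+_]; ∣_∣)
  import Data.Integer.Properties as ℤₚ
  open import Data.Nat as ℕ using (zero; suc; _+_; _*_; _∸_; _<_; _≤_)
  import Data.Nat.Properties as ℕₚ
  open import Data.Vec.Properties using (tabulate-cong)
  open import Relation.Binary.PropositionalEquality
  open import Defs using (Poly; coeffℤ; block)
  open ZMod p using (0ₚ)
  open Polynomial p using (coeff; _≋_; at)

  coeffℤ-cong : ∀ {F G} → F ≋ G → ∀ x → coeffℤ p F x ≡ coeffℤ p G x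
  coeffℤ-cong F≋G (+ i)    = at F≋G i
  coeffℤ-cong F≋G -[1+ _ ] = refl

  block-cong : ∀ {F G} → F ≋ G → ∀ j k → block p F j k ≡ block p G j k
  block-cong F≋G j k = tabulate-cong λ i → coeffℤ-cong F≋G (j ℤ.+ + toℕ i)

  coeffℤ-window : ∀ {F G : Poly p} {q Len} P →
                  (∀ t → t < q → coeff F (t + q * P) ≡ coeff G t) →
                  (∀ t i → Len ≤ t → t < q → coeff F (t + q * i) ≡ 0ₚ) →
                  ∀ x → ∣ x ∣ + Len < q → coeffℤ p F (x ℤ.+ + (q * P)) ≡ coeffℤ p G x
  coeffℤ-window {Len = Len} P window gaps (+ y) y+Len<q = window y (ℕₚ.≤-<-trans (ℕₚ.m≤m+n y Len) y+Len<q)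
  coeffℤ-window {F} {q = q} zero window gaps -[1+ y ] _ =
    cong (coeffℤ p F) (trans (cong (λ n → -[1+ y ] ℤ.+ + n) (ℕₚ.*-zeroʳ q)) (ℤₚ.+-identityʳ -[1+ y ]))
  coeffℤ-window {F} {q = q} {Len} (suc P) window gaps -[1+ y ] 1+y+Len<q = begin
    coeffℤ p F ((q * suc P) ℤ.⊖ suc y)       ≡⟨ cong (coeffℤ p F) (ℤₚ.⊖-≥ (ℕₚ.≤-trans 1+y≤q (ℕₚ.m≤m*n q (suc P)))) ⟩
    coeff F (q * suc P ∸ suc y)             ≡⟨ cong (coeff F) reindex ⟩
    coeff F ((q ∸ suc y) + q * P)           ≡⟨ gaps (q ∸ suc y) P Len≤q∸[1+y] (ℕₚ.∸-monoʳ-< (ℕ.s≤s ℕ.z≤n) 1+y≤q) ⟩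
    0ₚ                                      ∎
    where
      open ≡-Reasoning
      1+y≤q : suc y ≤ q
      1+y≤q = ℕₚ.<⇒≤ (ℕₚ.≤-<-trans (ℕₚ.m≤m+n (suc y) Len) 1+y+Len<q)
      reindex : q * suc P ∸ suc y ≡ (q ∸ suc y) + q * P
      reindex = trans (cong (_∸ suc y) (ℕₚ.*-suc q P)) (ℕₚ.+-∸-comm (q * P) 1+y≤q)
      Len≤q∸[1+y] : Len ≤ q ∸ suc y
      Len≤q∸[1+y] = ℕₚ.≤-trans (ℕₚ.≤-reflexive (sym (ℕₚ.m+n∸m≡n (suc y) Len))) (ℕₚ.∸-monoˡ-≤ (suc y) (ℕₚ.<⇒≤ 1+y+Len<q))

  block-window : ∀ {F G : Poly p} {q Len} P →
                 (∀ t → t < q → coeff F (t + q * P) ≡ coeff G t) →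
                 (∀ t i → Len ≤ t → t < q → coeff F (t + q * i) ≡ 0ₚ) →
                 ∀ j k → ∣ j ∣ + k + Len < q → block p F (j ℤ.+ + (q * P)) k ≡ block p G j k
  block-window {F} {q = q} {Len} P window gaps j k margin = tabulate-cong λ i →
    trans (cong (coeffℤ p F) (reorder (toℕ i))) (coeffℤ-window P window gaps (j ℤ.+ + toℕ i) (bound i))
    where
      reorder : ∀ t → (j ℤ.+ + (q * P)) ℤ.+ + t ≡ (j ℤ.+ + t) ℤ.+ + (q * P)
      reorder t = trans (ℤₚ.+-assoc j _ _) (trans (cong (λ z → j ℤ.+ z) (ℤₚ.+-comm (+ (q * P)) (+ t))) (sym (ℤₚ.+-assoc j _ _)))
      bound : ∀ (i : Fin k) → ∣ j ℤ.+ + toℕ i ∣ + Len < q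
      bound i = ℕₚ.≤-<-trans (ℕₚ.+-monoˡ-≤ Len (ℕₚ.≤-trans (ℤₚ.∣i+j∣≤∣i∣+∣j∣ j (+ toℕ i))
                                            (ℕₚ.+-monoʳ-≤ ∣ j ∣ (ℕₚ.<⇒≤ (toℕ<n i))))) margin

module LineComplexity (p : ℕ) .{{_ : NonZero p}} where

  open import Data.Product using (_,_)
  open import Function.Bundles using (_⇔_)
  open import Function.Construct.Composition using (_⇔-∘_)
  open import Defs using (Accessible; IsLineComplexity)

  isLineComplexity-transfer : ∀ {c S S′ k N} → (∀ w → Accessible p c S k w ⇔ Accessible p c S′ k w) →
                              IsLineComplexity p c S k N → IsLineComplexity p c S′ k N
  isLineComplexity-transfer S⇔S′ (ws , unique , ∈ws⇔S , length≡N) = ws , unique , (λ w → S⇔S′ w ⇔-∘ ∈ws⇔S w) , length≡N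

module Main (p : ℕ) .{{_ : NonZero p}} (pr : Prime p) (n′ : ℕ) (coprime : Coprime p (suc n′))
            (T : Poly p) (nonTrivial : NonTrivial p T) where

  open import Data.List using (length)
  open import Data.Integer as ℤ using (+_; ∣_∣)
  open import Data.Nat as ℕ using (suc; _+_; _*_; _<_; _≤_)
  import Data.Nat.Properties as ℕₚ
  open import Data.Nat.Divisibility using (_∣_; divides; quotient; ∣m∣n⇒∣m+n; m∣m*n)
  open import Data.Nat.Tactic.RingSolver using (solve-∀)
  open import Data.Product using (_×_; _,_; ∃₂)
  open import Relation.Binary.PropositionalEquality hiding ([_])
  open import Defs using (polyPow; line; block; Accessible)
  open ZModPrime p pr
  open PolynomialFrobenius p pr
  open LowestTermsOfPowers p pr
  open CoefficientsOfPowers p pr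
  open Blocks p
  open Arithmetic using (n<m^n; coprime⇒large-m^e≡1+n*h)

  n : ℕ
  n = suc n′

  lt : LowestTerms T
  lt = nonTrivial⇒lowestTerms nonTrivial

  open LowestTerms lt using (o; u; u≢0)

  line≋ : ∀ c S r → line p c S r ≋ scale c (S ^ᴾ r)
  line≋ c S r = ≡⇒≋ (cong (scale c) (polyPow≡^ᴾ S r))

  line-T^n≋ : ∀ c m → line p c (polyPow p T n) m ≋ scale c (T ^ᴾ (n * m))
  line-T^n≋ c m = ≋-trans (line≋ c (polyPow p T n) m)
    (scale-cong {c} refl (≋-trans (^ᴾ-congˡ m (≡⇒≋ (polyPow≡^ᴾ T n))) (^ᴾ-assocʳ T n m)))

  accessible-T^n⇒T : ∀ c {k w} → Accessible p c (polyPow p T n) k w → Accessible p c T k w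
  accessible-T^n⇒T c {k} (m , j , eq) =
    n * m , j , trans (block-cong (≋-trans (line≋ c T (n * m)) (≋-sym (line-T^n≋ c m))) j k) eq

  -- Some power T^s with s ≡ -r (mod n) has a coefficient equal to 1: multiply the lowest coefficient
  -- a = u^s₀ of T^s₀ by a coefficient a⁻¹ of a power of T^n, placed far enough away by Frobenius.
  unitCoefficient : ∀ r → ∃₂ λ s P → n ∣ r + s × coeff (T ^ᴾ s) P ≡ 1ₚ
  unitCoefficient r =
    let (b , i , [T^n]^b_i≡a⁻¹) = lowestTerms⇒coeffOfPower (coprime⇒lowestTerms-^ᴾ lt coprime) (⁻¹-≢0 a≢0)
    in  s₀ + (n * b) * q , o * s₀ + q * i , n∣r+s b , T^s_P≡1ₚ b i [T^n]^b_i≡a⁻¹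
    where
      s₀ = n′ * r
      a = u ^ₚ s₀
      a≢0 = ^ₚ-≢0 u≢0 s₀
      e = length (T ^ᴾ s₀) + o * s₀
      q = p ℕ.^ e
      e<q = n<m^n 1<p e
      n∣r+s : ∀ b → n ∣ r + (s₀ + (n * b) * q)
      n∣r+s b = divides (r + b * q) (regroup r n′ b q)
        where regroup : ∀ r n′ b q → r + (n′ * r + (suc n′ * b) * q) ≡ (r + b * q) * suc n′
              regroup = solve-∀
      T^s_P≡1ₚ : ∀ b i → coeff ((T ^ᴾ n) ^ᴾ b) i ≡ a ⁻¹ →
                 coeff (T ^ᴾ (s₀ + (n * b) * q)) (o * s₀ + q * i) ≡ 1ₚ
      T^s_P≡1ₚ b i [T^n]^b_i≡a⁻¹ = begin
        coeff (T ^ᴾ (s₀ + (n * b) * q)) (o * s₀ + q * i)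
          ≡⟨ coeff-^ᴾ-split T s₀ (n * b) e i (ℕₚ.≤-trans (ℕₚ.m≤m+n (length (T ^ᴾ s₀)) (o * s₀)) (ℕₚ.<⇒≤ e<q))
                                             (ℕₚ.≤-<-trans (ℕₚ.m≤n+m (o * s₀) (length (T ^ᴾ s₀))) e<q) ⟩
        coeff (T ^ᴾ s₀) (o * s₀) *ₚ coeff (T ^ᴾ (n * b)) i
          ≡⟨ cong₂ _*ₚ_ (coeff-^ᴾ-lowest lt s₀) (sym (at (^ᴾ-assocʳ T n b) i)) ⟩
        a *ₚ coeff ((T ^ᴾ n) ^ᴾ b) i  ≡⟨ cong (a *ₚ_) [T^n]^b_i≡a⁻¹ ⟩
        a *ₚ a ⁻¹                     ≡⟨ *ₚ-inverseʳ a≢0 ⟩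
        1ₚ                            ∎
        where open ≡-Reasoning

  -- With q = p^e ≡ 1 (mod n), n divides N = r + s q; by Frobenius T^N = T^r · T^s(x^q), which contains
  -- T^r · 1 around position qP, surrounded by zeros since T^r is shorter than q.
  accessible-window : ∀ {c k w} r j s P e h → block p (line p c T r) j k ≡ w →
                      n ∣ r + s → coeff (T ^ᴾ s) P ≡ 1ₚ →
                      ∣ j ∣ + k + length (T ^ᴾ r) < p ℕ.^ e → p ℕ.^ e ≡ 1 + n * h →
                      Accessible p c (polyPow p T n) k w
  accessible-window {c} {k} {w} r j s P e h eq n∣r+s T^s_P≡1ₚ B<q q≡1+n*h = m , j ℤ.+ + (q * P) , (begin
    block p (line p c (polyPow p T n) m) (j ℤ.+ + (q * P)) k ≡⟨ block-cong line-T^n≋F (j ℤ.+ + (q * P)) k ⟩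
    block p F (j ℤ.+ + (q * P)) k                         ≡⟨ block-window P window gaps j k B<q ⟩
    block p (line p c T r) j k                            ≡⟨ eq ⟩
    w                                                     ∎)
    where
      open ≡-Reasoning
      q = p ℕ.^ e
      N = r + s * q
      n∣N : n ∣ N
      n∣N = subst (n ∣_) (trans (regroup r s n h) (cong (λ x → r + s * x) (sym q≡1+n*h)))
                         (∣m∣n⇒∣m+n n∣r+s (m∣m*n (s * h)))
        where regroup : ∀ r s n h → r + s + n * (s * h) ≡ r + s * (1 + n * h)
              regroup = solve-∀
      m = quotient n∣N
      F = scale c (T ^ᴾ N)
      line-T^n≋F : line p c (polyPow p T n) m ≋ F
      line-T^n≋F = ≋-trans (line-T^n≋ c m)
        (≡⇒≋ (cong (λ x → scale c (T ^ᴾ x)) (trans (ℕₚ.*-comm n m) (sym (_∣_.equality n∣N)))))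
      |T^r|≤q : length (T ^ᴾ r) ≤ q
      |T^r|≤q = ℕₚ.≤-trans (ℕₚ.m≤n+m (length (T ^ᴾ r)) (∣ j ∣ + k)) (ℕₚ.<⇒≤ B<q)
      coeff-F : ∀ {t} i → t < q → coeff F (t + q * i) ≡ c *ₚ (coeff (T ^ᴾ r) t *ₚ coeff (T ^ᴾ s) i)
      coeff-F {t} i t<q = trans (coeff-scale c (T ^ᴾ N) (t + q * i))
        (cong (c *ₚ_) (coeff-^ᴾ-split T r s e i |T^r|≤q t<q))
      window : ∀ t → t < q → coeff F (t + q * P) ≡ coeff (line p c T r) t
      window t t<q = begin
        coeff F (t + q * P)                            ≡⟨ coeff-F P t<q ⟩
        c *ₚ (coeff (T ^ᴾ r) t *ₚ coeff (T ^ᴾ s) P)    ≡⟨ cong (λ x → c *ₚ (coeff (T ^ᴾ r) t *ₚ x)) T^s_P≡1ₚ ⟩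
        c *ₚ (coeff (T ^ᴾ r) t *ₚ 1ₚ)                  ≡⟨ cong (c *ₚ_) (*ₚ-identityʳ (coeff (T ^ᴾ r) t)) ⟩
        c *ₚ coeff (T ^ᴾ r) t                          ≡⟨ coeff-scale c (T ^ᴾ r) t ⟨
        coeff (scale c (T ^ᴾ r)) t                     ≡⟨ at (line≋ c T r) t ⟨
        coeff (line p c T r) t                         ∎
      gaps : ∀ t i → length (T ^ᴾ r) ≤ t → t < q → coeff F (t + q * i) ≡ 0ₚ
      gaps t i |T^r|≤t t<q = begin
        coeff F (t + q * i)                            ≡⟨ coeff-F i t<q ⟩
        c *ₚ (coeff (T ^ᴾ r) t *ₚ coeff (T ^ᴾ s) i)    ≡⟨ cong (λ x → c *ₚ (x *ₚ coeff (T ^ᴾ s) i))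
                                                             (coeff-≥length (T ^ᴾ r) |T^r|≤t) ⟩
        c *ₚ (0ₚ *ₚ coeff (T ^ᴾ s) i)                  ≡⟨ cong (c *ₚ_) (*ₚ-zeroˡ (coeff (T ^ᴾ s) i)) ⟩
        c *ₚ 0ₚ                                        ≡⟨ *ₚ-zeroʳ c ⟩
        0ₚ                                             ∎

  accessible-T⇒T^n : ∀ c {k w} → Accessible p c T k w → Accessible p c (polyPow p T n) k w
  accessible-T⇒T^n c {k} (r , j , eq) =
    let (s , P , n∣r+s , T^s_P≡1ₚ) = unitCoefficient r
        (e , h , B<q , q≡1+n*h)   = coprime⇒large-m^e≡1+n*h n 1<p coprime (∣ j ∣ + k + length (T ^ᴾ r))
    in  accessible-window {c} r j s P e h eq n∣r+s T^s_P≡1ₚ B<q q≡1+n*h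

open import Data.Fin using (Fin)
open import Data.Nat.Base using (zero; _≤_)
open import Data.Product using (_×_; _,_)
open import Data.Vec using (Vec)
open import Function.Bundles using (_⇔_; mk⇔)
open import Function.Construct.Symmetry using (⇔-sym)
open import Defs using (polyPow; Accessible; IsLineComplexity)
open LineComplexity using (isLineComplexity-transfer)

mainTheorem12 : (p : ℕ) .{{_ : NonZero p}} → Prime p →
    (n : ℕ) → 1 ≤ n → Coprime p n →
    (c : Fin p) (T : Poly p) → NonTrivial p T →
    ((k : ℕ) (w : Vec (Fin p) k) →
        Accessible p c T k w ⇔ Accessible p c (polyPow p T n) k w)
    × ((k N : ℕ) →
        IsLineComplexity p c T k N ⇔ IsLineComplexity p c (polyPow p T n) k N)
mainTheorem12 p pr zero     ()
mainTheorem12 p pr (suc n′) _ coprime c T nonTrivial =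
  accessible⇔ , λ k N → mk⇔ (isLineComplexity-transfer p {c} (accessible⇔ k))
                            (isLineComplexity-transfer p {c} (λ w → ⇔-sym (accessible⇔ k w)))
  where
    open Main p pr n′ coprime T nonTrivial using (accessible-T⇒T^n; accessible-T^n⇒T)
    accessible⇔ : ∀ k w → Accessible p c T k w ⇔ Accessible p c (polyPow p T (suc n′)) k w
    accessible⇔ k w = mk⇔ (accessible-T⇒T^n c) (accessible-T^n⇒T c)
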